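{- Let $N$ be a positive integer with $\sigma^{**}(N)=3N$, and let $e,f$ be the exponents with $2^e\,\|\,N$ and $3^f\,\|\,N$. If $e=4$ and $f\ge 5$, then $5\nmid N$.
   Context: $\sigma^{**}(N)$ is the sum of the biunitary divisors of $N$, where a divisor $d$ of $N$ is biunitary if the greatest common unitary divisor of $d$ and $N/d$ is $1$ (a divisor $d$ of $m$ being unitary if $\gcd(d,m/d)=1$). $p^a\,\|\,N$ means $p^a\mid N$ and $p^{a+1}\nmid N$. -}

module Defs where

open import Data.Nat using (ℕ; zero; suc; _+_; _*_; _^_; _/_; _≡ᵇ_; _<ᵇ_)
open import Data.Nat.Divisibility using (_∣_; _∣?_)
open import Data.Nat.GCD using (gcd)
open import Data.Bool using (Bool; true; false; _∧_; if_then_else_)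
open import Data.List using (List; filter; upTo; map; foldr)
open import Data.Nat.ListAction using (sum)
open import Data.Bool using (T?)
open import Relation.Nullary.Decidable using (⌊_⌋)
open import Relation.Binary.PropositionalEquality using (_≡_)
open import Relation.Nullary using (¬_)
open import Data.Product using (_×_)

divides? : ℕ → ℕ → Bool
divides? d m = ⌊ d ∣? m ⌋

isUnitaryDivisor : ℕ → ℕ → Bool
isUnitaryDivisor zero    m = false
isUnitaryDivisor (suc k) m = divides? (suc k) m ∧ (gcd (suc k) (m / suc k) ≡ᵇ 1)

oneTo : ℕ → List ℕ
oneTo n = map suc (upTo n)

maxList : List ℕ → ℕ
maxList = foldr (λ x y → if y <ᵇ x then x else y) 0

gcud : ℕ → ℕ → ℕ
gcud a b = maxList (filter (λ d → T? (isUnitaryDivisor d a ∧ isUnitaryDivisor d b)) (oneTo a))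

isBiunitaryDivisor : ℕ → ℕ → Bool
isBiunitaryDivisor zero    N = false
isBiunitaryDivisor (suc k) N = divides? (suc k) N ∧ (gcud (suc k) (N / suc k) ≡ᵇ 1)

σ** : ℕ → ℕ
σ** N = sum (filter (λ d → T? (isBiunitaryDivisor d N)) (oneTo N))

_^_∥_ : ℕ → ℕ → ℕ → Set
p ^ a ∥ N = (p ^ a ∣ N) × ¬ (p ^ suc a ∣ N)

-- Write N = 2⁴·3ᶠ·5ᵍ·M with g ≥ 1 and M coprime to 30. The biunitary divisors of pᵃ are the pⁱ
-- with i ≤ a and 2i ≠ a, and σ** is multiplicative, so σ**(N) = 3N reads
--   27 · σ**(3ᶠ) · σ**(5ᵍ) · σ**(M) = 48 · 3ᶠ · 5ᵍ · M,
-- whose right-hand side has exactly four factors 2. On the left, σ**(pᵃ) is even for odd p, so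
-- σ**(3ᶠ) and σ**(5ᵍ) are even and every prime factor of M contributes one more factor 2 to
-- σ**(M); moreover every prime p ≥ 7 dividing σ**(3ᶠ)σ**(5ᵍ) divides M. This budget of four
-- factors 2 is exceeded in almost every case: for f odd, σ**(3ᶠ) = (3ᶠ⁺¹ − 1)/2 is analysed
-- modulo 80; for 4 ∣ f, 16 divides σ**(3ᶠ); for f ≡ 2 (mod 4), σ**(3ᶠ) = 2A(3A + 2) where
-- 3^(f/2) = 2A + 1, and g = 2 and g = 4 supply too many prime factors. The cases g = 3, g ≥ 5
-- and (g = 1, f ≥ 10) contradict the size of σ**(N)/N = 3. Finally, for f = 6 and g ≤ 2 the
-- prime factors 13 and 41 of σ**(3⁶) = 2·13·41 exhaust the budget, so M = 13ᵃ·41ᵇ, which is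
-- excluded by a direct estimate.
module Submission where

open import Defs
open import Data.Bool using (Bool; true; false; _∧_; if_then_else_; T)
open import Data.Bool.Properties using (T?; T-∧)
open import Data.Empty using (⊥; ⊥-elim)
open import Data.List using ([]; _∷_; [_]; _++_; filter; map; upTo; length)
open import Data.List.Membership.Propositional using (_∈_)
open import Data.List.Membership.Propositional.Properties using (∈-map⁺; ∈-map⁻; ∈-upTo⁺; ∈-filter⁺; ∈-filter⁻)
open import Data.List.Properties using (map-++; upTo-∷ʳ; map-∘)
open import Data.List.Relation.Unary.All using (All; []; _∷_)
open import Data.List.Relation.Unary.Any using (here; there)
open import Data.List.Relation.Unary.Unique.Propositional using (Unique; []; _∷_)
open import Data.Nat
open import Data.Nat.Coprimality using (Coprime; coprime?; coprime-divisor; gcd≡1⇒coprime; coprime⇒gcd≡1; 1-coprimeTo) renaming (sym to coprime-sym)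
open import Data.Nat.Divisibility
open import Data.Nat.DivMod
open import Data.Nat.GCD using (gcd)
open import Data.Nat.Induction using (<-rec)
open import Data.Nat.ListAction using (sum; product)
open import Data.Nat.ListAction.Properties using (sum-++)
open import Data.Nat.Primality using (Prime; prime?; prime[2]; euclidsLemma; prime⇒nonZero; prime⇒nonTrivial; prime⇒irreducible; _Rough_; 2-rough; ∤⇒rough-suc; rough∧∣⇒rough; rough⇒≤)
open import Data.Nat.Primality.Factorisation using (factorise; PrimeFactorisation)
open import Data.Nat.Properties
open import Data.Nat.Tactic.RingSolver using (solve-∀)
open import Data.Product using (∃-syntax; _×_; _,_; proj₁; proj₂)
open import Data.Sum using (_⊎_; inj₁; inj₂; [_,_]′)
open import Function using (_∘_; flip; it; _⇔_; mk⇔; Equivalence)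
open import Relation.Binary.Definitions using (tri<; tri≈; tri>)
open import Relation.Binary.PropositionalEquality hiding ([_])
open import Relation.Nullary using (¬_; ¬?; _→-dec_; Dec; yes; no; contradiction)
open import Relation.Nullary.Decidable using (⌊_⌋; True; False; toWitness; toWitnessFalse; fromWitness; map′; from-yes; from-no)
open import Algebra.Properties.CommutativeSemigroup *-commutativeSemigroup using (x∙yz≈y∙xz)
open import Algebra.Properties.CommutativeSemigroup +-commutativeSemigroup using () renaming (interchange to +-interchange)

∑< : ℕ → (ℕ → ℕ) → ℕ
∑< zero    f = 0
∑< (suc n) f = ∑< n f + f n

syntax ∑< n (λ i → e) = ∑[ i < n ] e

∑<-cong : ∀ n {f g} → (∀ {i} → i < n → f i ≡ g i) → ∑< n f ≡ ∑< n g
∑<-cong zero    f≡g = refl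
∑<-cong (suc n) f≡g = cong₂ _+_ (∑<-cong n (f≡g ∘ m<n⇒m<1+n)) (f≡g ≤-refl)

∑<-≡0 : ∀ n {f} → (∀ {i} → i < n → f i ≡ 0) → ∑< n f ≡ 0
∑<-≡0 zero    f≡0 = refl
∑<-≡0 (suc n) f≡0 = cong₂ _+_ (∑<-≡0 n (f≡0 ∘ m<n⇒m<1+n)) (f≡0 ≤-refl)

∑<-mono-≤ : ∀ n {f g} → (∀ {i} → i < n → f i ≤ g i) → ∑< n f ≤ ∑< n g
∑<-mono-≤ zero    f≤g = z≤n
∑<-mono-≤ (suc n) f≤g = +-mono-≤ (∑<-mono-≤ n (f≤g ∘ m<n⇒m<1+n)) (f≤g ≤-refl)

∑<-+ : ∀ m k f → ∑< (m + k) f ≡ ∑< m f + ∑[ i < k ] f (m + i)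
∑<-+ m zero    f = trans (cong (λ n → ∑< n f) (+-identityʳ m)) (sym (+-identityʳ _))
∑<-+ m (suc k) f = begin
  ∑< (m + suc k) f                          ≡⟨ cong (λ n → ∑< n f) (+-suc m k) ⟩
  ∑< (m + k) f + f (m + k)                  ≡⟨ cong (_+ f (m + k)) (∑<-+ m k f) ⟩
  ∑< m f + ∑[ i < k ] f (m + i) + f (m + k) ≡⟨ +-assoc (∑< m f) _ _ ⟩
  ∑< m f + ∑[ i < suc k ] f (m + i)         ∎
  where open ≡-Reasoning

∑<-*ˡ : ∀ c n f → ∑[ i < n ] (c * f i) ≡ c * ∑< n f
∑<-*ˡ c zero    f = sym (*-zeroʳ c)
∑<-*ˡ c (suc n) f = trans (cong (_+ c * f n) (∑<-*ˡ c n f)) (sym (*-distribˡ-+ c (∑< n f) (f n)))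

∑<-*ʳ : ∀ c n f → ∑[ i < n ] (f i * c) ≡ ∑< n f * c
∑<-*ʳ c n f = trans (∑<-cong n (λ {i} _ → *-comm (f i) c)) (trans (∑<-*ˡ c n f) (*-comm c (∑< n f)))

∑<-distrib : ∀ n f g → ∑[ i < n ] (f i + g i) ≡ ∑< n f + ∑< n g
∑<-distrib zero    f g = refl
∑<-distrib (suc n) f g =
  trans (cong (_+ (f n + g n)) (∑<-distrib n f g)) (+-interchange (∑< n f) (∑< n g) (f n) (g n))

∑<-comm : ∀ m n (G : ℕ → ℕ → ℕ) → ∑[ j < n ] ∑[ i < m ] G i j ≡ ∑[ i < m ] ∑[ j < n ] G i j
∑<-comm m zero    G = sym (∑<-≡0 m (λ _ → refl))
∑<-comm m (suc n) G = trans (cong (_+ ∑[ i < m ] G i n) (∑<-comm m n G))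
                            (sym (∑<-distrib m (λ i → ∑[ j < n ] G i j) (λ i → G i n)))

∑<-single : ∀ n v f → v < n → (∀ {i} → i < n → i ≢ v → f i ≡ 0) → ∑< n f ≡ f v
∑<-single (suc n) v f v<1+n others with v ≟ n
... | yes refl = cong (_+ f v) (∑<-≡0 n (λ i<n → others (m<n⇒m<1+n i<n) (<⇒≢ i<n)))
... | no  v≢n  = begin
  ∑< n f + f n ≡⟨ cong (∑< n f +_) (others ≤-refl (v≢n ∘ sym)) ⟩
  ∑< n f + 0   ≡⟨ +-identityʳ _ ⟩
  ∑< n f       ≡⟨ ∑<-single n v f (≤∧≢⇒< (≤-pred v<1+n) v≢n) (others ∘ m<n⇒m<1+n) ⟩
  f v          ∎
  where open ≡-Reasoning

∑<-except : ∀ n v {f g} → v < n → f v ≡ 0 → (∀ {i} → i < n → i ≢ v → f i ≡ g i) → ∑< n f + g v ≡ ∑< n g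
∑<-except (suc n) v {f} {g} v<1+n fv≡0 f≡g with v ≟ n
... | yes refl = begin
  ∑< n f + f v + g v   ≡⟨ cong (λ x → ∑< n f + x + g v) fv≡0 ⟩
  ∑< n f + 0 + g v     ≡⟨ cong (_+ g v) (+-identityʳ (∑< n f)) ⟩
  ∑< n f + g v         ≡⟨ cong (_+ g v) (∑<-cong n (λ i<n → f≡g (m<n⇒m<1+n i<n) (<⇒≢ i<n))) ⟩
  ∑< n g + g v         ∎
  where open ≡-Reasoning
... | no v≢n = begin
  ∑< n f + f n + g v   ≡⟨ +-assoc (∑< n f) (f n) (g v) ⟩
  ∑< n f + (f n + g v) ≡⟨ cong (∑< n f +_) (+-comm (f n) (g v)) ⟩
  ∑< n f + (g v + f n) ≡⟨ +-assoc (∑< n f) (g v) (f n) ⟨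
  ∑< n f + g v + f n   ≡⟨ cong₂ _+_ (∑<-except n v v<n fv≡0 (f≡g ∘ m<n⇒m<1+n)) (f≡g ≤-refl (v≢n ∘ sym)) ⟩
  ∑< n g + g n         ∎
  where
  open ≡-Reasoning
  v<n = ≤∧≢⇒< (≤-pred v<1+n) v≢n

geometric : ∀ q n → q * ∑[ i < n ] (suc q ^ i) + 1 ≡ suc q ^ n
geometric q zero    = cong (_+ 1) (*-zeroʳ q)
geometric q (suc n) =
  trans (rearrange q (∑[ i < n ] (suc q ^ i)) (suc q ^ n)) (cong (_+ q * suc q ^ n) (geometric q n))
  where
  rearrange : ∀ q S x → q * (S + x) + 1 ≡ q * S + 1 + q * x
  rearrange = solve-∀

sum-map-upTo : ∀ g n → sum (map g (upTo n)) ≡ ∑< n g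
sum-map-upTo g zero    = refl
sum-map-upTo g (suc n) = begin
  sum (map g (upTo (suc n)))        ≡⟨ cong (sum ∘ map g) (upTo-∷ʳ n) ⟨
  sum (map g (upTo n ++ [ n ]))     ≡⟨ cong sum (map-++ g (upTo n) [ n ]) ⟩
  sum (map g (upTo n) ++ [ g n ])   ≡⟨ sum-++ (map g (upTo n)) [ g n ] ⟩
  sum (map g (upTo n)) + (g n + 0)  ≡⟨ cong₂ _+_ (sum-map-upTo g n) (+-identityʳ (g n)) ⟩
  ∑< n g + g n                      ∎
  where open ≡-Reasoning

sum-filter : ∀ (b : ℕ → Bool) xs →
             sum (filter (λ d → T? (b d)) xs) ≡ sum (map (λ d → if b d then d else 0) xs)
sum-filter b []       = refl
sum-filter b (x ∷ xs) with b x
... | true  = cong (x +_) (sum-filter b xs)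
... | false = sum-filter b xs

sum-filter-oneTo : ∀ (b : ℕ → Bool) n →
                   sum (filter (λ d → T? (b d)) (oneTo n)) ≡ ∑[ i < n ] (if b (suc i) then suc i else 0)
sum-filter-oneTo b n = begin
  sum (filter (λ d → T? (b d)) (oneTo n))   ≡⟨ sum-filter b (oneTo n) ⟩
  sum (map h (map suc (upTo n)))            ≡⟨ cong sum (map-∘ (upTo n)) ⟨
  sum (map (h ∘ suc) (upTo n))              ≡⟨ sum-map-upTo (h ∘ suc) n ⟩
  ∑< n (h ∘ suc)                            ∎
  where
  open ≡-Reasoning
  h : ℕ → ℕ
  h d = if b d then d else 0

-- Biunitary divisors

UnitaryDivisor : ℕ → ℕ → Set
UnitaryDivisor u x = ∃[ v ] x ≡ u * v × Coprime u v

NoCommonUnitaryDivisor : ℕ → ℕ → Set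
NoCommonUnitaryDivisor x y = ∀ {u} → 1 < u → UnitaryDivisor u x → UnitaryDivisor u y → ⊥

BiunitaryDivisor : ℕ → ℕ → Set
BiunitaryDivisor d N = ∃[ e ] N ≡ d * e × NoCommonUnitaryDivisor d e

module _ (F : ℕ → ℕ → ℕ) (k m : ℕ) where

  private
    d = suc k

    m/d≡ : ∀ {v} → m ≡ d * v → m / d ≡ v
    m/d≡ {v} m≡dv = trans (cong (_/ d) (trans m≡dv (*-comm d v))) (m*n/n≡m v d)

  T-divides∧≡ᵇ1 : T (divides? d m ∧ (F d (m / d) ≡ᵇ 1)) ⇔ (∃[ v ] m ≡ d * v × F d v ≡ 1)
  T-divides∧≡ᵇ1 = mk⇔ to from
    where
    to : T (divides? d m ∧ (F d (m / d) ≡ᵇ 1)) → ∃[ v ] m ≡ d * v × F d v ≡ 1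
    to t with Equivalence.to T-∧ t
    ... | d∣m , F≡1 with toWitness {a? = d ∣? m} d∣m
    ...   | divides v m≡vd = v , m≡dv , trans (cong (F d) (sym (m/d≡ m≡dv))) (≡ᵇ⇒≡ _ 1 F≡1)
      where m≡dv = trans m≡vd (*-comm v d)
    from : (∃[ v ] m ≡ d * v × F d v ≡ 1) → T (divides? d m ∧ (F d (m / d) ≡ᵇ 1))
    from (v , m≡dv , F≡1) = Equivalence.from T-∧
      ( fromWitness {a? = d ∣? m} (divides v (trans m≡dv (*-comm d v)))
      , ≡⇒≡ᵇ _ 1 (trans (cong (F d) (m/d≡ m≡dv)) F≡1))

isUnitaryDivisor⇔ : ∀ k m → T (isUnitaryDivisor (suc k) m) ⇔ UnitaryDivisor (suc k) m
isUnitaryDivisor⇔ k m = mk⇔ to from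
  where
  to : T (isUnitaryDivisor (suc k) m) → UnitaryDivisor (suc k) m
  to t with Equivalence.to (T-divides∧≡ᵇ1 gcd k m) t
  ... | v , m≡ , gcd≡1 = v , m≡ , gcd≡1⇒coprime gcd≡1
  from : UnitaryDivisor (suc k) m → T (isUnitaryDivisor (suc k) m)
  from (v , m≡ , coprime) = Equivalence.from (T-divides∧≡ᵇ1 gcd k m) (v , m≡ , coprime⇒gcd≡1 coprime)

unitaryDivisor⇒∣ : ∀ {u x} → UnitaryDivisor u x → u ∣ x
unitaryDivisor⇒∣ {u} (v , x≡uv , _) = divides v (trans x≡uv (*-comm u v))

unitaryDivisor-1 : ∀ x → UnitaryDivisor 1 x
unitaryDivisor-1 x = x , sym (*-identityˡ x) , 1-coprimeTo x

maxList-∷ : ∀ x xs → x ≤ maxList (x ∷ xs) × maxList xs ≤ maxList (x ∷ xs)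
maxList-∷ x xs with maxList xs <ᵇ x in eq
... | true  = ≤-refl , <⇒≤ (<ᵇ⇒< _ _ (subst T (sym eq) _))
... | false = ≮⇒≥ (λ lt → subst T eq (<⇒<ᵇ lt)) , ≤-refl

∈⇒≤maxList : ∀ {x xs} → x ∈ xs → x ≤ maxList xs
∈⇒≤maxList {x} {.x ∷ xs} (here refl) = proj₁ (maxList-∷ x xs)
∈⇒≤maxList {x} {y ∷ xs}  (there x∈xs) = ≤-trans (∈⇒≤maxList x∈xs) (proj₂ (maxList-∷ y xs))

maxList-≤ : ∀ {c} xs → (∀ {x} → x ∈ xs → x ≤ c) → maxList xs ≤ c
maxList-≤ []       bound = z≤n
maxList-≤ (x ∷ xs) bound with maxList xs <ᵇ x
... | true  = bound (here refl)
... | false = maxList-≤ xs (bound ∘ there)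

∈-oneTo⁺ : ∀ {k x} → suc k ≤ x → suc k ∈ oneTo x
∈-oneTo⁺ k<x = ∈-map⁺ suc (∈-upTo⁺ k<x)

gcud≡1⇔ : ∀ x y → .{{NonZero x}} → gcud x y ≡ 1 ⇔ NoCommonUnitaryDivisor x y
gcud≡1⇔ x y = mk⇔ to from
  where
  common : ℕ → Bool
  common d = isUnitaryDivisor d x ∧ isUnitaryDivisor d y

  common⁺ : ∀ {k} → UnitaryDivisor (suc k) x → UnitaryDivisor (suc k) y → suc k ≤ gcud x y
  common⁺ {k} ux uy = ∈⇒≤maxList (∈-filter⁺ (λ d → T? (common d))
    (∈-oneTo⁺ (∣⇒≤ (unitaryDivisor⇒∣ ux)))
    (Equivalence.from T-∧ (Equivalence.from (isUnitaryDivisor⇔ k x) ux ,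
                           Equivalence.from (isUnitaryDivisor⇔ k y) uy)))

  to : gcud x y ≡ 1 → NoCommonUnitaryDivisor x y
  to gcud≡1 {suc k} 1<u ux uy = <⇒≱ 1<u (subst (suc k ≤_) gcud≡1 (common⁺ ux uy))

  from : NoCommonUnitaryDivisor x y → gcud x y ≡ 1
  from ncu = ≤-antisym (maxList-≤ _ atMost1) (common⁺ (unitaryDivisor-1 x) (unitaryDivisor-1 y))
    where
    atMost1 : ∀ {d} → d ∈ filter (λ d → T? (common d)) (oneTo x) → d ≤ 1
    atMost1 d∈ with ∈-filter⁻ (λ d → T? (common d)) {xs = oneTo x} d∈
    ... | d∈oneTo , t with ∈-map⁻ suc d∈oneTo
    ...   | zero  , _ , refl = ≤-refl
    ...   | suc k , _ , refl with Equivalence.to T-∧ t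
    ...     | ux , uy = ⊥-elim (ncu (s≤s (s≤s z≤n)) (Equivalence.to (isUnitaryDivisor⇔ (suc k) x) ux)
                                                     (Equivalence.to (isUnitaryDivisor⇔ (suc k) y) uy))

isBiunitaryDivisor⇔ : ∀ k N → T (isBiunitaryDivisor (suc k) N) ⇔ BiunitaryDivisor (suc k) N
isBiunitaryDivisor⇔ k N = mk⇔ to from
  where
  to : T (isBiunitaryDivisor (suc k) N) → BiunitaryDivisor (suc k) N
  to t with Equivalence.to (T-divides∧≡ᵇ1 gcud k N) t
  ... | e , N≡ , gcud≡1 = e , N≡ , Equivalence.to (gcud≡1⇔ (suc k) e) gcud≡1
  from : BiunitaryDivisor (suc k) N → T (isBiunitaryDivisor (suc k) N)
  from (e , N≡ , ncu) =
    Equivalence.from (T-divides∧≡ᵇ1 gcud k N) (e , N≡ , Equivalence.from (gcud≡1⇔ (suc k) e) ncu)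

biunitaryDivisor? : ∀ d N → .{{NonZero d}} → Dec (BiunitaryDivisor d N)
biunitaryDivisor? (suc k) N =
  map′ (Equivalence.to (isBiunitaryDivisor⇔ k N)) (Equivalence.from (isBiunitaryDivisor⇔ k N))
       (T? (isBiunitaryDivisor (suc k) N))

biunitaryPart : ℕ → ℕ → ℕ
biunitaryPart N d = if isBiunitaryDivisor d N then d else 0

σ**≡∑ : ∀ N → σ** N ≡ ∑[ i < N ] biunitaryPart N (suc i)
σ**≡∑ N = sum-filter-oneTo (λ d → isBiunitaryDivisor d N) N

biunitaryPart-yes : ∀ {d N} → .{{NonZero d}} → BiunitaryDivisor d N → biunitaryPart N d ≡ d
biunitaryPart-yes {suc k} {N} bd with isBiunitaryDivisor (suc k) N in eq
... | true  = refl
... | false = ⊥-elim (subst T eq (Equivalence.from (isBiunitaryDivisor⇔ k N) bd))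

biunitaryPart-no : ∀ {d N} → ¬ BiunitaryDivisor d N → biunitaryPart N d ≡ 0
biunitaryPart-no {zero}      ¬bd = refl
biunitaryPart-no {suc k} {N} ¬bd with isBiunitaryDivisor (suc k) N in eq
... | true  = ⊥-elim (¬bd (Equivalence.to (isBiunitaryDivisor⇔ k N) (subst T (sym eq) _)))
... | false = refl


prime⇒≥2 : ∀ {p} → Prime p → 2 ≤ p
prime⇒≥2 {p} pp = nonTrivial⇒n>1 p {{prime⇒nonTrivial pp}}

prime-∤⇒coprime : ∀ {p x} → Prime p → p ∤ x → Coprime p x
prime-∤⇒coprime pp p∤x (d∣p , d∣x) with prime⇒irreducible pp d∣p
... | inj₁ d≡1 = d≡1
... | inj₂ refl = contradiction d∣x p∤x

coprime-*ˡ : ∀ {a b c} → Coprime a c → Coprime b c → Coprime (a * b) c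
coprime-*ˡ {a} {b} {c} ac bc {d} (d∣ab , d∣c) = bc (coprime-divisor da d∣ab , d∣c)
  where
  da : Coprime d a
  da (e∣d , e∣a) = ac (e∣a , ∣-trans e∣d d∣c)

coprime-^ˡ : ∀ {a c} → Coprime a c → ∀ n → Coprime (a ^ n) c
coprime-^ˡ {c = c} ac zero    = 1-coprimeTo c
coprime-^ˡ         ac (suc n) = coprime-*ˡ ac (coprime-^ˡ ac n)

∤-* : ∀ {p a b} → Prime p → p ∤ a → p ∤ b → p ∤ a * b
∤-* {a = a} {b} pp p∤a p∤b p∣ab with euclidsLemma a b pp p∣ab
... | inj₁ p∣a = p∤a p∣a
... | inj₂ p∣b = p∤b p∣b

∣^⇒∣ : ∀ {q m} → Prime q → ∀ n → q ∣ m ^ n → q ∣ m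
∣^⇒∣ pq zero    q∣1 = contradiction (∣1⇒≡1 q∣1) (>⇒≢ (prime⇒≥2 pq))
∣^⇒∣ {m = m} pq (suc n) q∣m*mⁿ with euclidsLemma m (m ^ n) pq q∣m*mⁿ
... | inj₁ q∣m  = q∣m
... | inj₂ q∣mⁿ = ∣^⇒∣ pq n q∣mⁿ

∤-^ : ∀ {q m} → Prime q → q ∤ m → ∀ n → q ∤ m ^ n
∤-^ pq q∤m n = q∤m ∘ ∣^⇒∣ pq n

prime∣prime⇒≡ : ∀ {q p} → Prime q → Prime p → q ∣ p → q ≡ p
prime∣prime⇒≡ pq pp q∣p with prime⇒irreducible pp q∣p
... | inj₁ q≡1 = contradiction q≡1 (>⇒≢ (prime⇒≥2 pq))
... | inj₂ q≡p = q≡p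

prime[3] : Prime 3
prime[3] = from-yes (prime? 3)

prime[5] : Prime 5
prime[5] = from-yes (prime? 5)

prime[7] : Prime 7
prime[7] = from-yes (prime? 7)

prime[13] : Prime 13
prime[13] = from-yes (prime? 13)

prime[41] : Prime 41
prime[41] = from-yes (prime? 41)

module _ {p : ℕ} (pp : Prime p) where

  private instance
    p≢0 : NonZero p
    p≢0 = prime⇒nonZero pp

  prime-power-split : ∀ n → .{{NonZero n}} → ∃[ v ] ∃[ m ] n ≡ p ^ v * m × p ∤ m
  prime-power-split n {{n≢0}} = <-rec Split split n n≢0
    where
    Split : ℕ → Set
    Split n = .(NonZero n) → ∃[ v ] ∃[ m ] n ≡ p ^ v * m × p ∤ m
    split : ∀ n → (∀ {q} → q < n → Split q) → Split n
    split n rec n≢0 with p ∣? n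
    ... | no  p∤n = 0 , n , sym (*-identityˡ n) , p∤n
    ... | yes (divides q refl) with rec q<n q≢0
      where
      q≢0 : NonZero q
      q≢0 = m*n≢0⇒m≢0 q {{n≢0}}
      q<n : q < q * p
      q<n = m<m*n q p {{q≢0}} (prime⇒≥2 pp)
    ...   | v , m , q≡pᵛm , p∤m =
      suc v , m , trans (*-comm q p) (trans (cong (p *_) q≡pᵛm) (sym (*-assoc p (p ^ v) m))) , p∤m

  p∣p^[1+n]*m : ∀ n m → p ∣ p ^ suc n * m
  p∣p^[1+n]*m n m = ∣-trans (m∣m*n (p ^ n)) (m∣m*n m)

  prime-power-unique : ∀ v w {x y} → p ^ v * x ≡ p ^ w * y → p ∤ x → p ∤ y → v ≡ w
  prime-power-unique zero    zero    eq p∤x p∤y = refl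
  prime-power-unique zero    (suc w) {x} {y} eq p∤x p∤y =
    contradiction (subst (p ∣_) (trans (sym eq) (*-identityˡ x)) (p∣p^[1+n]*m w y)) p∤x
  prime-power-unique (suc v) zero    {x} {y} eq p∤x p∤y =
    contradiction (subst (p ∣_) (trans eq (*-identityˡ y)) (p∣p^[1+n]*m v x)) p∤y
  prime-power-unique (suc v) (suc w) {x} {y} eq p∤x p∤y = cong suc (prime-power-unique v w pᵛx≡pʷy p∤x p∤y)
    where
    pᵛx≡pʷy : p ^ v * x ≡ p ^ w * y
    pᵛx≡pʷy = *-cancelˡ-≡ _ _ p (trans (sym (*-assoc p (p ^ v) x)) (trans eq (*-assoc p (p ^ w) y)))

  p^i∣p^v*x⇒i≤v : ∀ i v {x} → p ^ i ∣ p ^ v * x → p ∤ x → i ≤ v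
  p^i∣p^v*x⇒i≤v zero    v       _ _ = z≤n
  p^i∣p^v*x⇒i≤v (suc i) zero    {x} pⁱ∣x p∤x =
    contradiction (∣-trans (m∣m*n (p ^ i)) (subst (p ^ suc i ∣_) (*-identityˡ x) pⁱ∣x)) p∤x
  p^i∣p^v*x⇒i≤v (suc i) (suc v) {x} pⁱ∣pᵛx p∤x =
    s≤s (p^i∣p^v*x⇒i≤v i v (*-cancelˡ-∣ p (subst (p ^ suc i ∣_) (*-assoc p (p ^ v) x) pⁱ∣pᵛx)) p∤x)

  p^[1+n]>1 : ∀ n → 1 < p ^ suc n
  p^[1+n]>1 n = <-≤-trans (prime⇒≥2 pp) (m≤m*n p (p ^ n) {{m^n≢0 p n}})

  unitaryDivisor-^ : ∀ v {x} → p ∤ x → UnitaryDivisor (p ^ v) (p ^ v * x)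
  unitaryDivisor-^ v {x} p∤x = x , refl , coprime-^ˡ (prime-∤⇒coprime pp p∤x) v

  unitaryDivisor-*ᵖ : ∀ v {u x} → p ∤ x → UnitaryDivisor u x → UnitaryDivisor u (p ^ v * x)
  unitaryDivisor-*ᵖ v {u} {x} p∤x (s , refl , u⊥s) =
    p ^ v * s , x∙yz≈y∙xz (p ^ v) u s , coprime-sym (coprime-*ˡ (coprime-^ˡ p⊥u v) (coprime-sym u⊥s))
    where
    p⊥u : Coprime p u
    p⊥u = prime-∤⇒coprime pp (λ p∣u → p∤x (∣-trans p∣u (m∣m*n s)))

  unitaryDivisor-/ᵖ : ∀ v {u x} → .{{NonZero u}} → p ∤ u →
                      UnitaryDivisor u (p ^ v * x) → UnitaryDivisor u x
  unitaryDivisor-/ᵖ v {u} {x} p∤u (s , pᵛx≡us , u⊥s) = t , x≡ut , u⊥t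
    where
    u∣x : u ∣ x
    u∣x = coprime-divisor (coprime-sym (coprime-^ˡ (prime-∤⇒coprime pp p∤u) v))
                          (divides s (trans pᵛx≡us (*-comm u s)))
    t = quotient u∣x
    x≡ut : x ≡ u * t
    x≡ut = trans (_∣_.equality u∣x) (*-comm t u)
    s≡pᵛt : s ≡ p ^ v * t
    s≡pᵛt = *-cancelˡ-≡ s (p ^ v * t) u
              (trans (sym pᵛx≡us) (trans (cong (p ^ v *_) x≡ut) (x∙yz≈y∙xz (p ^ v) u t)))
    u⊥t : Coprime u t
    u⊥t (d∣u , d∣t) = u⊥s (d∣u , subst (_ ∣_) (sym s≡pᵛt) (∣n⇒∣m*n (p ^ v) d∣t))

  unitaryDivisor-exponent : ∀ v j {x u} → p ∤ x → p ∤ u →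
                            UnitaryDivisor (p ^ suc j * u) (p ^ v * x) → v ≡ suc j
  unitaryDivisor-exponent v j {x} {u} p∤x p∤u (s , pᵛx≡ , coprime) =
    prime-power-unique v (suc j) (trans pᵛx≡ (*-assoc (p ^ suc j) u s)) p∤x (∤-* pp p∤u p∤s)
    where
    p∤s : p ∤ s
    p∤s p∣s = <⇒≢ (prime⇒≥2 pp) (sym (coprime (p∣p^[1+n]*m j u , p∣s)))

  noCommonUnitaryDivisor-^* : ∀ v w {x y} → p ∤ x → p ∤ y →
    NoCommonUnitaryDivisor (p ^ v * x) (p ^ w * y) ⇔ ((v ≡ w → v ≡ 0) × NoCommonUnitaryDivisor x y)
  noCommonUnitaryDivisor-^* v w {x} {y} p∤x p∤y = mk⇔ to from
    where
    to : NoCommonUnitaryDivisor (p ^ v * x) (p ^ w * y) → (v ≡ w → v ≡ 0) × NoCommonUnitaryDivisor x y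
    to ncu = v≡w⇒v≡0 , λ 1<u ux uy → ncu 1<u (unitaryDivisor-*ᵖ v p∤x ux)
                                              (unitaryDivisor-*ᵖ w p∤y uy)
      where
      same-exponent : ∀ n → NoCommonUnitaryDivisor (p ^ n * x) (p ^ n * y) → n ≡ 0
      same-exponent zero    _    = refl
      same-exponent (suc j) ncu′ =
        ⊥-elim (ncu′ (p^[1+n]>1 j) (unitaryDivisor-^ (suc j) p∤x) (unitaryDivisor-^ (suc j) p∤y))
      v≡w⇒v≡0 : v ≡ w → v ≡ 0
      v≡w⇒v≡0 refl = same-exponent v ncu
    from : (v ≡ w → v ≡ 0) × NoCommonUnitaryDivisor x y → NoCommonUnitaryDivisor (p ^ v * x) (p ^ w * y)
    from (v≡w⇒v≡0 , ncu) {u} 1<u ux uy with prime-power-split u {{>-nonZero (<-trans z<s 1<u)}}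
    ... | zero  , u′ , u≡u′ , p∤u′ =
      ncu 1<u (unitaryDivisor-/ᵖ v {{u≢0}} p∤u ux) (unitaryDivisor-/ᵖ w {{u≢0}} p∤u uy)
      where
      u≢0 = >-nonZero (<-trans z<s 1<u)
      p∤u : p ∤ u
      p∤u = subst (p ∤_) (sym (trans u≡u′ (*-identityˡ u′))) p∤u′
    ... | suc j , u′ , refl , p∤u′
      with unitaryDivisor-exponent v j p∤x p∤u′ ux | unitaryDivisor-exponent w j p∤y p∤u′ uy
    ...   | refl | refl = contradiction (v≡w⇒v≡0 refl) λ ()

  ^-+-*-interchange : ∀ v w x y → p ^ (v + w) * (x * y) ≡ (p ^ v * x) * (p ^ w * y)
  ^-+-*-interchange v w x y =
    trans (cong (_* (x * y)) (^-distribˡ-+-* p v w)) ([m*n]*[o*p]≡[m*o]*[n*p] (p ^ v) (p ^ w) x y)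

  biunitaryDivisor-^* : ∀ a v {M d} → .{{NonZero M}} → 1 ≤ a → p ∤ M → p ∤ d →
    BiunitaryDivisor (p ^ v * d) (p ^ a * M) ⇔ (v ≤ a × v + v ≢ a × BiunitaryDivisor d M)
  biunitaryDivisor-^* a v {M} {d} 1≤a p∤M p∤d = mk⇔ to from
    where
    to : BiunitaryDivisor (p ^ v * d) (p ^ a * M) → v ≤ a × v + v ≢ a × BiunitaryDivisor d M
    to (e , pᵃM≡ , ncu) with prime-power-split e {{e≢0}}
      where
      e≢0 : NonZero e
      e≢0 = m*n≢0⇒n≢0 (p ^ v * d) {{subst NonZero pᵃM≡ (m*n≢0 (p ^ a) M {{m^n≢0 p a}})}}
    ... | w , e′ , refl , p∤e′ = v≤a , v+v≢a , e′ , M≡de′ , proj₂ ncu′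
      where
      pᵃM≡pᵛ⁺ʷde′ : p ^ a * M ≡ p ^ (v + w) * (d * e′)
      pᵃM≡pᵛ⁺ʷde′ = trans pᵃM≡ (sym (^-+-*-interchange v w d e′))
      a≡v+w : a ≡ v + w
      a≡v+w = prime-power-unique a (v + w) pᵃM≡pᵛ⁺ʷde′ p∤M (∤-* pp p∤d p∤e′)
      v≤a : v ≤ a
      v≤a = subst (v ≤_) (sym a≡v+w) (m≤m+n v w)
      M≡de′ : M ≡ d * e′
      M≡de′ = *-cancelˡ-≡ M (d * e′) (p ^ a) {{m^n≢0 p a}}
                (trans pᵃM≡pᵛ⁺ʷde′ (cong (λ n → p ^ n * (d * e′)) (sym a≡v+w)))
      ncu′ = Equivalence.to (noCommonUnitaryDivisor-^* v w p∤d p∤e′) ncu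
      v+v≢a : v + v ≢ a
      v+v≢a v+v≡a with proj₁ ncu′ (+-cancelˡ-≡ v v w (trans v+v≡a a≡v+w))
      ... | refl = <⇒≢ 1≤a v+v≡a
    from : v ≤ a × v + v ≢ a × BiunitaryDivisor d M → BiunitaryDivisor (p ^ v * d) (p ^ a * M)
    from (v≤a , v+v≢a , e′ , M≡de′ , ncu′) =
      p ^ (a ∸ v) * e′ , pᵃM≡ ,
      Equivalence.from (noCommonUnitaryDivisor-^* v (a ∸ v) p∤d p∤e′) (v≢a∸v , ncu′)
      where
      p∤e′ : p ∤ e′
      p∤e′ p∣e′ = p∤M (∣-trans p∣e′ (divides d M≡de′))
      pᵃM≡ : p ^ a * M ≡ (p ^ v * d) * (p ^ (a ∸ v) * e′)
      pᵃM≡ = trans (cong₂ (λ n m → p ^ n * m) (sym (m+[n∸m]≡n v≤a)) M≡de′)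
                   (^-+-*-interchange v (a ∸ v) d e′)
      v≢a∸v : v ≡ a ∸ v → v ≡ 0
      v≢a∸v v≡a∸v = contradiction (trans (cong (v +_) v≡a∸v) (m+[n∸m]≡n v≤a)) v+v≢a


-- Multiplicativity of σ**

-- σ**(pᵃ): the biunitary divisors of pᵃ are the pⁱ with i ≤ a and 2i ≠ a.
σ**-term : ℕ → ℕ → ℕ → ℕ
σ**-term p a i = if ⌊ i + i ≟ a ⌋ then 0 else p ^ i

σ**-pow : ℕ → ℕ → ℕ
σ**-pow p a = ∑[ i < suc a ] σ**-term p a i

σ**-term-≢ : ∀ p a i → i + i ≢ a → σ**-term p a i ≡ p ^ i
σ**-term-≢ p a i i+i≢a with i + i ≟ a
... | yes i+i≡a = contradiction i+i≡a i+i≢a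
... | no  _     = refl

σ**-term-≡ : ∀ p a i → i + i ≡ a → σ**-term p a i ≡ 0
σ**-term-≡ p a i i+i≡a with i + i ≟ a
... | yes _     = refl
... | no  i+i≢a = contradiction i+i≡a i+i≢a

dilate : ℕ → (ℕ → ℕ) → ℕ → ℕ
dilate c g d with c ∣? d
... | yes (divides q _) = g q
... | no  _             = 0

dilate-yes : ∀ c g {d} q → .{{NonZero c}} → d ≡ q * c → dilate c g d ≡ g q
dilate-yes c g {d} q d≡qc with c ∣? d
... | yes (divides q′ d≡q′c) = cong g (*-cancelʳ-≡ q′ q c (trans (sym d≡q′c) d≡qc))
... | no  c∤d                = contradiction (divides q d≡qc) c∤d

dilate-no : ∀ c g {d} → c ∤ d → dilate c g d ≡ 0
dilate-no c g {d} c∤d with c ∣? d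
... | yes c∣d = contradiction c∣d c∤d
... | no  _   = refl

∑-dilate : ∀ c g K → .{{NonZero c}} → ∑[ j < c * K ] dilate c g (suc j) ≡ ∑[ j < K ] g (suc j)
∑-dilate c g zero    rewrite *-zeroʳ c = refl
∑-dilate c@(suc c′) g (suc K) = begin
  ∑[ j < c * suc K ] h j                        ≡⟨ cong (λ n → ∑< n h) c*[1+K]≡c*K+c ⟩
  ∑[ j < c * K + c ] h j                        ≡⟨ ∑<-+ (c * K) c h ⟩
  ∑[ j < c * K ] h j + ∑[ t < c ] h (c * K + t) ≡⟨ cong₂ _+_ (∑-dilate c g K) last-block ⟩
  ∑[ j < K ] g (suc j) + g (suc K)              ∎
  where
  open ≡-Reasoning
  h : ℕ → ℕ
  h j = dilate c g (suc j)
  c*[1+K]≡c*K+c : c * suc K ≡ c * K + c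
  c*[1+K]≡c*K+c = trans (*-suc c K) (+-comm c (c * K))
  last-block : ∑[ t < c ] h (c * K + t) ≡ g (suc K)
  last-block = trans (∑<-single c c′ (λ t → h (c * K + t)) ≤-refl off) on
    where
    on : h (c * K + c′) ≡ g (suc K)
    on = dilate-yes c g (suc K) (trans (sym (+-suc (c * K) c′)) (trans (sym c*[1+K]≡c*K+c) (*-comm c (suc K))))
    off : ∀ {t} → t < c → t ≢ c′ → h (c * K + t) ≡ 0
    off {t} t<c t≢c′ = dilate-no c g c∤
      where
      c∤ : c ∤ suc (c * K + t)
      c∤ c∣ = <⇒≱ (s≤s (≤∧≢⇒< (≤-pred t<c) t≢c′))
                  (∣⇒≤ (∣m+n∣m⇒∣n (subst (c ∣_) (sym (+-suc (c * K) t)) c∣) (m∣m*n K)))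

∑-biunitaryPart : ∀ M K → .{{NonZero M}} → M ≤ K → ∑[ j < K ] biunitaryPart M (suc j) ≡ σ** M
∑-biunitaryPart M K M≤K = begin
  ∑< K h                                ≡⟨ cong (λ n → ∑< n h) (m+[n∸m]≡n M≤K) ⟨
  ∑< (M + (K ∸ M)) h                    ≡⟨ ∑<-+ M (K ∸ M) h ⟩
  ∑< M h + ∑[ t < K ∸ M ] h (M + t)     ≡⟨ cong (∑< M h +_) (∑<-≡0 (K ∸ M) (λ _ → biunitaryPart-no too-large)) ⟩
  ∑< M h + 0                            ≡⟨ +-identityʳ _ ⟩
  ∑< M h                                ≡⟨ σ**≡∑ M ⟨
  σ** M                                 ∎
  where
  open ≡-Reasoning
  h : ℕ → ℕ
  h j = biunitaryPart M (suc j)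
  too-large : ∀ {t} → ¬ BiunitaryDivisor (suc (M + t)) M
  too-large {t} (e , M≡ , _) = <⇒≱ (s≤s (m≤m+n M t)) (∣⇒≤ (divides e (trans M≡ (*-comm _ e))))

module _ {p : ℕ} (pp : Prime p) where

  private instance
    p≢0 : NonZero p
    p≢0 = prime⇒nonZero pp

  biunitaryPart-^* : ∀ a {M} → .{{NonZero M}} → 1 ≤ a → p ∤ M → ∀ d → .{{NonZero d}} →
    biunitaryPart (p ^ a * M) d ≡ ∑[ i < suc a ] (σ**-term p a i * dilate (p ^ i) (biunitaryPart M) d)
  biunitaryPart-^* a {M} 1≤a p∤M d with prime-power-split pp d
  ... | v , d′ , refl , p∤d′ = part≡∑ (v ≤? a)
    where
    D : ℕ → ℕ
    D i = dilate (p ^ i) (biunitaryPart M) (p ^ v * d′)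

    term : ℕ → ℕ
    term i = σ**-term p a i * D i

    bd⇔ = biunitaryDivisor-^* pp a v 1≤a p∤M p∤d′

    D-off : ∀ {i} → i ≢ v → D i ≡ 0
    D-off {i} i≢v = off (p ^ i ∣? p ^ v * d′)
      where
      off : Dec (p ^ i ∣ p ^ v * d′) → D i ≡ 0
      off (no pⁱ∤d) = dilate-no (p ^ i) (biunitaryPart M) pⁱ∤d
      off (yes (divides q d≡qpⁱ)) =
        trans (dilate-yes (p ^ i) (biunitaryPart M) q {{m^n≢0 p i}} d≡qpⁱ) (biunitaryPart-no ¬bd)
        where
        i≤v : i ≤ v
        i≤v = p^i∣p^v*x⇒i≤v pp i v (divides q d≡qpⁱ) p∤d′
        q≡ : q ≡ p ^ (v ∸ i) * d′
        q≡ = *-cancelˡ-≡ q _ (p ^ i) {{m^n≢0 p i}} (begin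
          p ^ i * q                  ≡⟨ *-comm (p ^ i) q ⟩
          q * p ^ i                  ≡⟨ d≡qpⁱ ⟨
          p ^ v * d′                 ≡⟨ cong (λ n → p ^ n * d′) (m+[n∸m]≡n i≤v) ⟨
          p ^ (i + (v ∸ i)) * d′     ≡⟨ cong (_* d′) (^-distribˡ-+-* p i (v ∸ i)) ⟩
          p ^ i * p ^ (v ∸ i) * d′   ≡⟨ *-assoc (p ^ i) _ d′ ⟩
          p ^ i * (p ^ (v ∸ i) * d′) ∎)
          where open ≡-Reasoning
        p∣q : p ∣ q
        p∣q with v ∸ i | m<n⇒0<n∸m (≤∧≢⇒< i≤v i≢v) | q≡
        ... | suc w | _ | q≡′ = subst (p ∣_) (sym q≡′) (p∣p^[1+n]*m pp w d′)
        ¬bd : ¬ BiunitaryDivisor q M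
        ¬bd (e , M≡qe , _) = p∤M (∣-trans p∣q (divides e (trans M≡qe (*-comm q e))))

    term-off : ∀ {i} → i ≢ v → term i ≡ 0
    term-off {i} i≢v = trans (cong (σ**-term p a i *_) (D-off i≢v)) (*-zeroʳ (σ**-term p a i))

    term-v : term v ≡ σ**-term p a v * biunitaryPart M d′
    term-v = cong (σ**-term p a v *_) (dilate-yes (p ^ v) (biunitaryPart M) d′ {{m^n≢0 p v}} (*-comm (p ^ v) d′))

    part≡∑ : Dec (v ≤ a) → biunitaryPart (p ^ a * M) (p ^ v * d′) ≡ ∑< (suc a) term
    part≡∑ (no v≰a) =
      trans (biunitaryPart-no (λ bd → v≰a (proj₁ (Equivalence.to bd⇔ bd))))
            (sym (∑<-≡0 (suc a) (λ {i} i<1+a → term-off {i} (λ { refl → v≰a (≤-pred i<1+a) }))))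
    part≡∑ (yes v≤a) = trans part≡term-v (sym (trans (∑<-single (suc a) v term (s≤s v≤a) (λ _ → term-off)) term-v))
      where
      d′≢0 : NonZero d′
      d′≢0 = m*n≢0⇒n≢0 (p ^ v)
      part≡term-v : biunitaryPart (p ^ a * M) (p ^ v * d′) ≡ σ**-term p a v * biunitaryPart M d′
      part≡term-v with biunitaryDivisor? (p ^ v * d′) (p ^ a * M)
      ... | yes bd = let _ , v+v≢a , bd′ = Equivalence.to bd⇔ bd in
        trans (biunitaryPart-yes bd) (sym (cong₂ _*_ (σ**-term-≢ p a v v+v≢a) (biunitaryPart-yes {{d′≢0}} bd′)))
      ... | no ¬bd = trans (biunitaryPart-no ¬bd) (sym (term-v≡0 (v + v ≟ a)))
        where
        term-v≡0 : Dec (v + v ≡ a) → σ**-term p a v * biunitaryPart M d′ ≡ 0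
        term-v≡0 (yes v+v≡a) = cong (_* biunitaryPart M d′) (σ**-term-≡ p a v v+v≡a)
        term-v≡0 (no  v+v≢a) =
          trans (cong (σ**-term p a v *_) (biunitaryPart-no ¬bd′)) (*-zeroʳ (σ**-term p a v))
          where
          ¬bd′ : ¬ BiunitaryDivisor d′ M
          ¬bd′ bd′ = ¬bd (Equivalence.from bd⇔ (v≤a , v+v≢a , bd′))

  σ**-^* : ∀ a {M} → .{{NonZero M}} → 1 ≤ a → p ∤ M → σ** (p ^ a * M) ≡ σ**-pow p a * σ** M
  σ**-^* a {M} 1≤a p∤M = begin
    σ** N                                      ≡⟨ σ**≡∑ N ⟩
    ∑[ j < N ] biunitaryPart N (suc j)         ≡⟨ ∑<-cong N (λ {j} _ → biunitaryPart-^* a 1≤a p∤M (suc j)) ⟩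
    ∑[ j < N ] ∑[ i < suc a ] G i j            ≡⟨ ∑<-comm (suc a) N G ⟩
    ∑[ i < suc a ] ∑[ j < N ] G i j            ≡⟨ ∑<-cong (suc a) column ⟩
    ∑[ i < suc a ] (σ**-term p a i * σ** M)    ≡⟨ ∑<-*ʳ (σ** M) (suc a) (σ**-term p a) ⟩
    σ**-pow p a * σ** M                        ∎
    where
    open ≡-Reasoning
    N = p ^ a * M
    G : ℕ → ℕ → ℕ
    G i j = σ**-term p a i * dilate (p ^ i) (biunitaryPart M) (suc j)
    column : ∀ {i} → i < suc a → ∑[ j < N ] G i j ≡ σ**-term p a i * σ** M
    column {i} i<1+a = begin
      ∑[ j < N ] G i j                 ≡⟨ ∑<-*ˡ (σ**-term p a i) N _ ⟩
      σ**-term p a i * ∑< N D          ≡⟨ cong (λ n → σ**-term p a i * ∑< n D) N≡pⁱK ⟩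
      σ**-term p a i * ∑< (p ^ i * K) D ≡⟨ cong (σ**-term p a i *_) (∑-dilate (p ^ i) _ K {{m^n≢0 p i}}) ⟩
      σ**-term p a i * ∑< K B          ≡⟨ cong (σ**-term p a i *_) (∑-biunitaryPart M K M≤K) ⟩
      σ**-term p a i * σ** M           ∎
      where
      D B : ℕ → ℕ
      D j = dilate (p ^ i) (biunitaryPart M) (suc j)
      B j = biunitaryPart M (suc j)
      K = p ^ (a ∸ i) * M
      M≤K : M ≤ K
      M≤K = m≤n*m M (p ^ (a ∸ i)) {{m^n≢0 p (a ∸ i)}}
      N≡pⁱK : N ≡ p ^ i * K
      N≡pⁱK = trans (cong (λ n → p ^ n * M) (sym (m+[n∸m]≡n (≤-pred i<1+a))))
                    (trans (cong (_* M) (^-distribˡ-+-* p i (a ∸ i))) (*-assoc (p ^ i) (p ^ (a ∸ i)) M))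

-- Parity and size of σ**(pᵃ)

even⊎odd : ∀ a → (∃[ h ] a ≡ h + h) ⊎ (∃[ h ] a ≡ suc (h + h))
even⊎odd zero    = inj₁ (0 , refl)
even⊎odd (suc a) with even⊎odd a
... | inj₁ (h , refl) = inj₂ (h , refl)
... | inj₂ (h , refl) = inj₁ (suc h , cong suc (sym (+-suc h h)))

i+i≢1+h+h : ∀ i h → i + i ≢ suc (h + h)
i+i≢1+h+h zero    h       ()
i+i≢1+h+h (suc i) zero    eq = 1+n≢0 (trans (sym (+-suc i i)) (suc-injective eq))
i+i≢1+h+h (suc i) (suc h) eq =
  i+i≢1+h+h i h (suc-injective (trans (sym (+-suc i i)) (trans (suc-injective eq) (cong suc (+-suc h h)))))

i+i≡h+h⇒i≡h : ∀ {i h} → i + i ≡ h + h → i ≡ h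
i+i≡h+h⇒i≡h {i} {h} eq with <-cmp i h
... | tri< i<h _ _ = contradiction eq (<⇒≢ (+-mono-< i<h i<h))
... | tri≈ _ i≡h _ = i≡h
... | tri> _ _ h<i = contradiction eq (≢-sym (<⇒≢ (+-mono-< h<i h<i)))

σ**-pow-odd : ∀ p h → σ**-pow p (suc (h + h)) ≡ ∑[ i < suc (suc (h + h)) ] (p ^ i)
σ**-pow-odd p h = ∑<-cong (suc (suc (h + h))) (λ {i} _ → σ**-term-≢ p (suc (h + h)) i (i+i≢1+h+h i h))

σ**-pow-even : ∀ p h → σ**-pow p (h + h) + p ^ h ≡ ∑[ i < suc (h + h) ] (p ^ i)
σ**-pow-even p h = ∑<-except (suc (h + h)) h (s≤s (m≤m+n h h)) (σ**-term-≡ p (h + h) h refl)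
  (λ {i} _ i≢h → σ**-term-≢ p (h + h) i (i≢h ∘ i+i≡h+h⇒i≡h))

2∣n⊎2∣1+n : ∀ n → 2 ∣ n ⊎ 2 ∣ suc n
2∣n⊎2∣1+n zero    = inj₁ (divides 0 refl)
2∣n⊎2∣1+n (suc n) with 2∣n⊎2∣1+n n
... | inj₁ 2∣n   = inj₂ (∣m∣n⇒∣m+n ∣-refl 2∣n)
... | inj₂ 2∣1+n = inj₁ 2∣1+n

2∤⇒2∣1+ : ∀ {n} → 2 ∤ n → 2 ∣ suc n
2∤⇒2∣1+ {n} 2∤n with 2∣n⊎2∣1+n n
... | inj₁ 2∣n   = contradiction 2∣n 2∤n
... | inj₂ 2∣1+n = 2∣1+n

module _ {p : ℕ} (2∤p : 2 ∤ p) where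

  2∣∑<-even-length : ∀ m → 2 ∣ ∑[ i < m + m ] (p ^ i)
  2∣∑<-even-length zero    = divides 0 refl
  2∣∑<-even-length (suc m) =
    subst (2 ∣_) (sym ∑≡) (∣m∣n⇒∣m+n (2∣∑<-even-length m) (∣n⇒∣m*n (p ^ (m + m)) (2∤⇒2∣1+ 2∤p)))
    where
    pair : ∀ S x p → S + x + p * x ≡ S + x * suc p
    pair = solve-∀
    ∑≡ : ∑[ i < suc m + suc m ] (p ^ i) ≡ ∑[ i < m + m ] (p ^ i) + p ^ (m + m) * suc p
    ∑≡ = trans (cong (λ n → ∑[ i < suc n ] (p ^ i)) (+-suc m m)) (pair (∑[ i < m + m ] (p ^ i)) (p ^ (m + m)) p)

  2∣σ**-pow : ∀ a → 2 ∣ σ**-pow p a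
  2∣σ**-pow a with even⊎odd a
  ... | inj₂ (h , refl) = subst (2 ∣_) (sym σ**-pow≡) (2∣∑<-even-length (suc h))
    where
    σ**-pow≡ : σ**-pow p (suc (h + h)) ≡ ∑[ i < suc h + suc h ] (p ^ i)
    σ**-pow≡ = trans (σ**-pow-odd p h) (cong (λ n → ∑[ i < suc n ] (p ^ i)) (sym (+-suc h h)))
  ... | inj₁ (h , refl) = ∣m+n∣m⇒∣n (subst (2 ∣_) (sym ∑≡) 2∣rhs) (∣m⇒∣m*n x ∣-refl)
    where
    x = p ^ h
    S = ∑[ i < h + h ] (p ^ i)
    ∑≡ : 2 * x + σ**-pow p (h + h) ≡ S + x * suc x
    ∑≡ = begin
      2 * x + σ**-pow p (h + h)    ≡⟨ rearrange x (σ**-pow p (h + h)) ⟩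
      σ**-pow p (h + h) + x + x    ≡⟨ cong (_+ x) (σ**-pow-even p h) ⟩
      S + p ^ (h + h) + x          ≡⟨ cong (λ y → S + y + x) (^-distribˡ-+-* p h h) ⟩
      S + x * x + x                ≡⟨ square S x ⟩
      S + x * suc x                ∎
      where
      open ≡-Reasoning
      rearrange : ∀ x s → 2 * x + s ≡ s + x + x
      rearrange = solve-∀
      square : ∀ S x → S + x * x + x ≡ S + x * suc x
      square = solve-∀
    2∣rhs : 2 ∣ S + x * suc x
    2∣rhs = ∣m∣n⇒∣m+n (2∣∑<-even-length h) (∣n⇒∣m*n x (2∤⇒2∣1+ (∤-^ prime[2] 2∤p h)))

σ**-term-≤ : ∀ p a i → σ**-term p a i ≤ p ^ i
σ**-term-≤ p a i with i + i ≟ a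
... | yes _ = z≤n
... | no  _ = ≤-refl

σ**-pow-< : ∀ q a → q * σ**-pow (suc q) a < suc q ^ suc a
σ**-pow-< q a = begin-strict
  q * σ**-pow (suc q) a                ≤⟨ *-monoʳ-≤ q (∑<-mono-≤ (suc a) (λ {i} _ → σ**-term-≤ (suc q) a i)) ⟩
  q * ∑[ i < suc a ] (suc q ^ i)       <⟨ m<m+n _ z<s ⟩
  q * ∑[ i < suc a ] (suc q ^ i) + 1   ≡⟨ geometric q (suc a) ⟩
  suc q ^ suc a                        ∎
  where open ≤-Reasoning

σ**-pow-≥-top-terms : ∀ p n a → n + n < a → p ^ a * ∑[ t < suc n ] (p ^ t) ≤ p ^ n * σ**-pow p a
σ**-pow-≥-top-terms p n a 2n<a with m≤n⇒∃[o]m+o≡n (≤-trans (m≤m+n n n) (<⇒≤ 2n<a))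
... | b , refl = begin
  p ^ (n + b) * ∑< (suc n) (p ^_)       ≡⟨ cong (_* ∑< (suc n) (p ^_)) (^-distribˡ-+-* p n b) ⟩
  p ^ n * p ^ b * ∑< (suc n) (p ^_)     ≡⟨ *-assoc (p ^ n) (p ^ b) _ ⟩
  p ^ n * (p ^ b * ∑< (suc n) (p ^_))   ≡⟨ cong (p ^ n *_) (∑<-*ˡ (p ^ b) (suc n) (p ^_)) ⟨
  p ^ n * ∑[ t < suc n ] (p ^ b * p ^ t) ≤⟨ *-monoʳ-≤ (p ^ n) top-terms ⟩
  p ^ n * σ**-pow p (n + b)             ∎
  where
  open ≤-Reasoning
  n<b : n < b
  n<b = +-cancelˡ-< n n b 2n<a
  term : ℕ → ℕ
  term = σ**-term p (n + b)
  present : ∀ t → p ^ b * p ^ t ≡ term (b + t)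
  present t = trans (sym (^-distribˡ-+-* p b t)) (sym (σ**-term-≢ p (n + b) (b + t) b+t≢))
    where
    b+t≢ : b + t + (b + t) ≢ n + b
    b+t≢ eq = <⇒≢ (≤-trans (+-monoˡ-< b n<b) (+-mono-≤ (m≤m+n b t) (m≤m+n b t))) (sym eq)
  top-terms : ∑[ t < suc n ] (p ^ b * p ^ t) ≤ σ**-pow p (n + b)
  top-terms = begin
    ∑[ t < suc n ] (p ^ b * p ^ t)            ≡⟨ ∑<-cong (suc n) (λ {t} _ → present t) ⟩
    ∑[ t < suc n ] term (b + t)               ≤⟨ m≤n+m _ (∑< b term) ⟩
    ∑< b term + ∑[ t < suc n ] term (b + t)   ≡⟨ ∑<-+ b (suc n) term ⟨
    ∑< (b + suc n) term                       ≡⟨ cong (λ k → ∑< k term) (trans (+-suc b n) (cong suc (+-comm b n))) ⟩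
    σ**-pow p (n + b)                         ∎

σ**-pow-≥-top : ∀ p a → 1 ≤ a → p ^ a ≤ σ**-pow p a
σ**-pow-≥-top p a 1≤a = subst₂ _≤_ (*-identityʳ (p ^ a)) (+-identityʳ (σ**-pow p a)) (σ**-pow-≥-top-terms p 0 a 1≤a)

σ**-pow-≥-top-two : ∀ p a → 1 ≤ a → a ≢ 2 → p ^ a * suc p ≤ p * σ**-pow p a
σ**-pow-≥-top-two p 1 _ _ = ≤-reflexive (eq p)
  where
  eq : ∀ p → p * 1 * suc p ≡ p * (0 + 1 + p * 1)
  eq = solve-∀
σ**-pow-≥-top-two p 2 _ a≢2 = contradiction refl a≢2
σ**-pow-≥-top-two p a@(suc (suc (suc _))) _ _ =
  subst₂ _≤_ (cong (p ^ a *_) (eq p)) (cong (_* σ**-pow p a) (*-identityʳ p))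
         (σ**-pow-≥-top-terms p 1 a (s≤s (s≤s (s≤s z≤n))))
  where
  eq : ∀ p → 0 + 1 + p * 1 ≡ suc p
  eq = solve-∀

σ**-≥ : ∀ M → .{{NonZero M}} → M ≤ σ** M
σ**-≥ (suc m) = begin
  suc m                                         ≡⟨ biunitaryPart-yes self ⟨
  biunitaryPart (suc m) (suc m)                 ≤⟨ m≤n+m _ _ ⟩
  ∑[ j < suc m ] biunitaryPart (suc m) (suc j)  ≡⟨ σ**≡∑ (suc m) ⟨
  σ** (suc m)                                   ∎
  where
  open ≤-Reasoning
  self : BiunitaryDivisor (suc m) (suc m)
  self = 1 , sym (*-identityʳ (suc m)) , λ 1<u _ u∣1 → <⇒≢ 1<u (sym (∣1⇒≡1 (unitaryDivisor⇒∣ u∣1)))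

prime-factor : ∀ n → 2 ≤ n → ∃[ p ] Prime p × p ∣ n
prime-factor n 2≤n = first-factor (PrimeFactorisation.factors fac) (PrimeFactorisation.isFactorisation fac)
                                  (PrimeFactorisation.factorsPrime fac)
  where
  fac = factorise n {{>-nonZero (<-trans z<s 2≤n)}}
  first-factor : ∀ ps → n ≡ product ps → All Prime ps → ∃[ p ] Prime p × p ∣ n
  first-factor []       n≡1 _         = contradiction n≡1 (>⇒≢ 2≤n)
  first-factor (p ∷ ps) n≡  (pp ∷ _) = p , pp , subst (p ∣_) (sym n≡) (m∣m*n (product ps))

no-prime-factor⇒≡1 : ∀ n → .{{NonZero n}} → (∀ {r} → Prime r → r ∤ n) → n ≡ 1
no-prime-factor⇒≡1 1               _   = refl
no-prime-factor⇒≡1 n@(suc (suc _)) r∤n with prime-factor n (s≤s (s≤s z≤n))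
... | r , pr , r∣n = contradiction r∣n (r∤n pr)

rough-prime-factor : ∀ {m t} → 2 ≤ t → m Rough t → ∃[ p ] Prime p × m ≤ p × p ∣ t
rough-prime-factor 2≤t rough with prime-factor _ 2≤t
... | p , pp , p∣t = p , pp , rough⇒≤ {{prime⇒nonTrivial pp}} (rough∧∣⇒rough rough p∣t) , p∣t

7-rough : ∀ {t} → 2 ∤ t → 3 ∤ t → 5 ∤ t → 7 Rough t
7-rough 2∤t 3∤t 5∤t =
  ∤⇒rough-suc (2∤t ∘ ∣-trans (divides 3 refl)) (∤⇒rough-suc 5∤t (∤⇒rough-suc (2∤t ∘ ∣-trans (divides 2 refl))
    (∤⇒rough-suc 3∤t (∤⇒rough-suc 2∤t 2-rough))))

prime-power-free-part : ∀ {p t} → Prime p → .{{NonZero t}} → (∀ v → t ≢ p ^ v) →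
                        ∃[ n ] 2 ≤ n × n ∣ t × p ∤ n
prime-power-free-part {p} {t} pp t≢pᵛ with prime-power-split pp t
... | v , 0               , t≡pᵛ0 , _   = contradiction (trans t≡pᵛ0 (*-zeroʳ (p ^ v))) (≢-nonZero⁻¹ t)
... | v , 1               , t≡pᵛ1 , _   = contradiction (trans t≡pᵛ1 (*-identityʳ (p ^ v))) (t≢pᵛ v)
... | v , n@(suc (suc _)) , t≡pᵛn , p∤n = n , s≤s (s≤s z≤n) , divides (p ^ v) t≡pᵛn , p∤n

record PrimePowerSplit (p M : ℕ) : Set where
  field
    exponent cofactor : ℕ
    1≤exponent        : 1 ≤ exponent
    M≡                : M ≡ p ^ exponent * cofactor
    p∤cofactor        : p ∤ cofactor
    σ**≡              : σ** M ≡ σ**-pow p exponent * σ** cofactor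

  cofactor∣M : cofactor ∣ M
  cofactor∣M = divides (p ^ exponent) M≡

  cofactor≢0 : .{{NonZero M}} → NonZero cofactor
  cofactor≢0 = m*n≢0⇒n≢0 (p ^ exponent) {{subst NonZero M≡ it}}

prime-power-split-σ** : ∀ {p} → Prime p → ∀ M → .{{NonZero M}} → p ∣ M → PrimePowerSplit p M
prime-power-split-σ** {p} pp M p∣M with prime-power-split pp M
... | zero  , M′ , M≡ , p∤M′ = contradiction (subst (p ∣_) (trans M≡ (*-identityˡ M′)) p∣M) p∤M′
... | suc a , M′ , M≡ , p∤M′ = record
  { exponent = suc a ; cofactor = M′ ; 1≤exponent = s≤s z≤n ; M≡ = M≡ ; p∤cofactor = p∤M′
  ; σ**≡ = trans (cong σ** M≡) (σ**-^* pp (suc a) {{M′≢0}} (s≤s z≤n) p∤M′) }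
  where
  M′≢0 : NonZero M′
  M′≢0 = m*n≢0⇒n≢0 (p ^ suc a) {{subst NonZero M≡ it}}

∣p^e*c⇒∣c : ∀ {q p e c} → Prime q → Prime p → q ≢ p → q ∣ p ^ e * c → q ∣ c
∣p^e*c⇒∣c {e = e} {c} pq pp q≢p q∣pᵉc with euclidsLemma (_ ^ e) c pq q∣pᵉc
... | inj₁ q∣pᵉ = contradiction (prime∣prime⇒≡ pq pp (∣^⇒∣ pq e q∣pᵉ)) q≢p
... | inj₂ q∣c  = q∣c

2^length∣σ** : ∀ ps {M} → .{{NonZero M}} → 2 ∤ M →
               All Prime ps → Unique ps → All (_∣ M) ps → 2 ^ length ps ∣ σ** M
2^length∣σ** []       _   _  _ _ = 1∣ _
2^length∣σ** (p ∷ ps) {M} 2∤M (pp ∷ pps) (p∉ps ∷ unique) (p∣M ∷ ps∣M) =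
  subst (2 ^ length (p ∷ ps) ∣_) (sym σ**≡)
        (*-pres-∣ (2∣σ**-pow (2∤M ∘ flip ∣-trans p∣M) exponent)
                  (2^length∣σ** ps {{cofactor≢0}} (2∤M ∘ flip ∣-trans cofactor∣M) pps unique
                                (divide-cofactor pps p∉ps ps∣M)))
  where
  open PrimePowerSplit (prime-power-split-σ** pp M p∣M)
  divide-cofactor : ∀ {qs} → All Prime qs → All (p ≢_) qs → All (_∣ M) qs → All (_∣ cofactor) qs
  divide-cofactor []         []           []           = []
  divide-cofactor (pq ∷ pqs) (p≢q ∷ p≢qs) (q∣M ∷ qs∣M) =
    ∣p^e*c⇒∣c {e = exponent} pq pp (p≢q ∘ sym) (subst (_ ∣_) M≡ q∣M) ∷ divide-cofactor pqs p≢qs qs∣M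

σ**-two-prime-powers : ∀ {p q M} → Prime p → Prime q → p ≢ q → .{{NonZero M}} → p ∣ M → q ∣ M →
  (∀ {r} → Prime r → r ∣ M → r ≡ p ⊎ r ≡ q) →
  ∃[ a ] ∃[ b ] 1 ≤ a × 1 ≤ b × M ≡ p ^ a * q ^ b × σ** M ≡ σ**-pow p a * σ**-pow q b
σ**-two-prime-powers {p} {q} {M} pp pq p≢q p∣M q∣M only-p-q =
  P.exponent , Q.exponent , P.1≤exponent , Q.1≤exponent , M≡ , σ**M≡
  where
  module P = PrimePowerSplit (prime-power-split-σ** pp M p∣M)
  M₁ = P.cofactor
  instance M₁≢0 = P.cofactor≢0
  q∣M₁ : q ∣ M₁
  q∣M₁ = ∣p^e*c⇒∣c {e = P.exponent} pq pp (p≢q ∘ sym) (subst (q ∣_) P.M≡ q∣M)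
  module Q = PrimePowerSplit (prime-power-split-σ** pq M₁ q∣M₁)
  M₂ = Q.cofactor
  instance M₂≢0 = Q.cofactor≢0
  M₂≡1 : M₂ ≡ 1
  M₂≡1 = no-prime-factor⇒≡1 M₂ λ pr r∣M₂ → excluded pr r∣M₂ (only-p-q pr (∣-trans r∣M₂ M₂∣M))
    where
    M₂∣M : M₂ ∣ M
    M₂∣M = ∣-trans Q.cofactor∣M P.cofactor∣M
    excluded : ∀ {r} → Prime r → r ∣ M₂ → r ≡ p ⊎ r ≡ q → ⊥
    excluded _ r∣M₂ (inj₁ refl) = P.p∤cofactor (∣-trans r∣M₂ Q.cofactor∣M)
    excluded _ r∣M₂ (inj₂ refl) = Q.p∤cofactor r∣M₂
  M≡ : M ≡ p ^ P.exponent * q ^ Q.exponent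
  M≡ = trans P.M≡ (cong (p ^ P.exponent *_) (trans Q.M≡ (trans (cong (q ^ Q.exponent *_) M₂≡1) (*-identityʳ _))))
  σ**M≡ : σ** M ≡ σ**-pow p P.exponent * σ**-pow q Q.exponent
  σ**M≡ = trans P.σ**≡ (cong (σ**-pow p P.exponent *_) (trans Q.σ**≡ σ**M₁≡))
    where
    σ**M₁≡ : σ**-pow q Q.exponent * σ** M₂ ≡ σ**-pow q Q.exponent
    σ**M₁≡ = trans (cong (λ m → σ**-pow q Q.exponent * σ** m) M₂≡1) (*-identityʳ _)

module _ {d : ℕ} .{{_ : NonZero d}} where

  %-cong-* : ∀ {a a′ b b′} → a % d ≡ a′ % d → b % d ≡ b′ % d → (a * b) % d ≡ (a′ * b′) % d
  %-cong-* {a} {a′} {b} {b′} a≡a′ b≡b′ = begin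
    (a * b) % d                 ≡⟨ %-distribˡ-* a b d ⟩
    ((a % d) * (b % d)) % d     ≡⟨ cong₂ (λ x y → (x * y) % d) a≡a′ b≡b′ ⟩
    ((a′ % d) * (b′ % d)) % d   ≡⟨ %-distribˡ-* a′ b′ d ⟨
    (a′ * b′) % d               ∎
    where open ≡-Reasoning

  ^-%-cong : ∀ {a b} → a % d ≡ b % d → ∀ n → a ^ n % d ≡ b ^ n % d
  ^-%-cong a≡b zero    = refl
  ^-%-cong a≡b (suc n) = %-cong-* a≡b (^-%-cong a≡b n)

  ^-%-periodic : ∀ b T .{{_ : NonZero T}} → b ^ T % d ≡ 1 % d → ∀ n → b ^ n % d ≡ b ^ (n % T) % d
  ^-%-periodic b T bᵀ≡1 n = begin
    b ^ n % d                              ≡⟨ cong (λ k → b ^ k % d) n≡ ⟩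
    b ^ (r + T * q) % d                    ≡⟨ cong (_% d) (^-distribˡ-+-* b r (T * q)) ⟩
    (b ^ r * b ^ (T * q)) % d              ≡⟨ cong (λ x → (b ^ r * x) % d) (^-*-assoc b T q) ⟨
    (b ^ r * (b ^ T) ^ q) % d              ≡⟨ %-cong-* {a = b ^ r} refl (^-%-cong bᵀ≡1 q) ⟩
    (b ^ r * 1 ^ q) % d                    ≡⟨ cong (λ x → (b ^ r * x) % d) (^-zeroˡ q) ⟩
    (b ^ r * 1) % d                        ≡⟨ cong (_% d) (*-identityʳ (b ^ r)) ⟩
    b ^ r % d                              ∎
    where
    open ≡-Reasoning
    r = n % T
    q = n / T
    n≡ : n ≡ r + T * q
    n≡ = trans (m≡m%n+[m/n]*n n T) (cong (r +_) (*-comm q T))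

  ∣⇒[1+m]%n≡1%n : ∀ {m} → d ∣ m → (1 + m) % d ≡ 1 % d
  ∣⇒[1+m]%n≡1%n d∣m = %-remove-+ʳ 1 d∣m

m%n≡c⇒m≡c+[m/n]*n : ∀ m n {c} .{{_ : NonZero n}} → m % n ≡ c → m ≡ c + m / n * n
m%n≡c⇒m≡c+[m/n]*n m n m%n≡c = trans (m≡m%n+[m/n]*n m n) (cong (_+ m / n * n) m%n≡c)

[1+m]%n≡1⇒n∣m : ∀ m n .{{_ : NonZero n}} → (1 + m) % n ≡ 1 → n ∣ m
[1+m]%n≡1⇒n∣m m n eq = divides ((1 + m) / n) (suc-injective (m%n≡c⇒m≡c+[m/n]*n (1 + m) n eq))

∤-affine : ∀ {d} a b Z → d ∤ a → d ∣ b → d ∤ a + b * Z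
∤-affine {d} a b Z d∤a d∣b d∣ = d∤a (∣m+n∣m⇒∣n (subst (d ∣_) (+-comm a (b * Z)) d∣) (∣m⇒∣m*n Z d∣b))

2∤∧5∤-affine : ∀ a b Z {2∤a : False (2 ∣? a)} {5∤a : False (5 ∣? a)} {10∣b : True (10 ∣? b)} →
               2 ∤ a + b * Z × 5 ∤ a + b * Z
2∤∧5∤-affine a b Z {2∤a} {5∤a} {10∣b} =
  ∤-affine a b Z (toWitnessFalse 2∤a) (∣-trans (divides 5 refl) (toWitness 10∣b)) ,
  ∤-affine a b Z (toWitnessFalse 5∤a) (∣-trans (divides 2 refl) (toWitness 10∣b))

∣m⇒∣1+m⇒∣1 : ∀ {d m} → d ∣ m → d ∣ 1 + m → d ∣ 1
∣m⇒∣1+m⇒∣1 {d} {m} d∣m d∣1+m = ∣m+n∣m⇒∣n (subst (d ∣_) (+-comm 1 m) d∣1+m) d∣m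

3∤-next-to-power : ∀ {m a x} → 1 ≤ m → 1 + a * x ≡ 3 ^ m ⊎ 1 + 3 ^ m ≡ a * x → 3 ∤ x
3∤-next-to-power {suc m} {a} {x} _ eq 3∣x = from-no (3 ∣? 1) (3∣1 eq)
  where
  3∣ax : 3 ∣ a * x
  3∣ax = ∣n⇒∣m*n a 3∣x
  3∣3^m : 3 ∣ 3 ^ suc m
  3∣3^m = m∣m*n (3 ^ m)
  3∣1 : 1 + a * x ≡ 3 ^ suc m ⊎ 1 + 3 ^ suc m ≡ a * x → 3 ∣ 1
  3∣1 (inj₁ eq) = ∣m⇒∣1+m⇒∣1 3∣ax (subst (3 ∣_) (sym eq) 3∣3^m)
  3∣1 (inj₂ eq) = ∣m⇒∣1+m⇒∣1 3∣3^m (subst (3 ∣_) (sym eq) 3∣ax)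

2*m+1≡2*n+1⇒m≡n : ∀ {m n} → 2 * m + 1 ≡ 2 * n + 1 → m ≡ n
2*m+1≡2*n+1⇒m≡n {m} {n} eq = *-cancelˡ-≡ m n 2 (+-cancelʳ-≡ 1 (2 * m) (2 * n) eq)

lower-bound⇒2≤ : ∀ {x} a b c → c ≤ b + a * x → b + a * 1 < c → 2 ≤ x
lower-bound⇒2≤ a b c c≤ lt = ≮⇒≥ (λ x<2 → <⇒≱ (≤-<-trans (+-monoʳ-≤ b (*-monoʳ-≤ a (≤-pred x<2))) lt) c≤)

-- Powers of three

-- v₂(s) plus the number of prime factors p ≥ 7 of s is at least 4
data Weight≥4 (s : ℕ) : Set where
  16∣           : 16 ∣ s → Weight≥4 s
  8∣+prime      : 8 ∣ s → ∀ {p} → Prime p → 7 ≤ p → p ∣ s → Weight≥4 s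
  4∣+two-primes : 4 ∣ s → ∀ {p q} → Prime p → Prime q → 7 ≤ p → 7 ≤ q → p ≢ q → p ∣ s → q ∣ s → Weight≥4 s

3^m-mod-80 : ∀ m → ∃[ Z ] (3 ^ m ≡ 1 + Z * 80 ⊎ 3 ^ m ≡ 3 + Z * 80 ⊎ 3 ^ m ≡ 9 + Z * 80 ⊎ 3 ^ m ≡ 27 + Z * 80)
3^m-mod-80 m = Z , residue (m % 4) (m%n<n m 4) (^-%-periodic {80} 3 4 refl m)
  where
  Z = 3 ^ m / 80
  residue : ∀ r → r < 4 → 3 ^ m % 80 ≡ 3 ^ r % 80 →
            3 ^ m ≡ 1 + Z * 80 ⊎ 3 ^ m ≡ 3 + Z * 80 ⊎ 3 ^ m ≡ 9 + Z * 80 ⊎ 3 ^ m ≡ 27 + Z * 80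
  residue 0 _ 3ᵐ%80 = inj₁ (m%n≡c⇒m≡c+[m/n]*n (3 ^ m) 80 3ᵐ%80)
  residue 1 _ 3ᵐ%80 = inj₂ (inj₁ (m%n≡c⇒m≡c+[m/n]*n (3 ^ m) 80 3ᵐ%80))
  residue 2 _ 3ᵐ%80 = inj₂ (inj₂ (inj₁ (m%n≡c⇒m≡c+[m/n]*n (3 ^ m) 80 3ᵐ%80)))
  residue 3 _ 3ᵐ%80 = inj₂ (inj₂ (inj₂ (m%n≡c⇒m≡c+[m/n]*n (3 ^ m) 80 3ᵐ%80)))
  residue (suc (suc (suc (suc _)))) (s≤s (s≤s (s≤s (s≤s ())))) _

module _ {m s : ℕ} (3≤m : 3 ≤ m) (sq : 2 * s + 1 ≡ 3 ^ m * 3 ^ m) where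

  private
    1≤m : 1 ≤ m
    1≤m = ≤-trans (s≤s z≤n) 3≤m
    27≤3^m : 27 ≤ 3 ^ m
    27≤3^m = ^-monoʳ-≤ 3 3≤m

  -- s = 4uw with u = (3ᵐ − 1)/2 and w = (3ᵐ + 1)/4 coprime
  weight-coprime-halves : ∀ {u w} → 1 + 2 * u ≡ 3 ^ m → 1 + 3 ^ m ≡ 4 * w →
                          2 ∤ u × 5 ∤ u → 2 ∤ w × 5 ∤ w → Weight≥4 s
  weight-coprime-halves {u} {w} u≡ w≡ (2∤u , 5∤u) (2∤w , 5∤w)
    with rough-prime-factor 2≤u (7-rough 2∤u (3∤-next-to-power {a = 2} 1≤m (inj₁ u≡)) 5∤u)
       | rough-prime-factor 2≤w (7-rough 2∤w (3∤-next-to-power {a = 4} 1≤m (inj₂ w≡)) 5∤w)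
    where
    2≤u : 2 ≤ u
    2≤u = lower-bound⇒2≤ 2 1 27 (subst (27 ≤_) (sym u≡) 27≤3^m) (from-yes (3 <? 27))
    2≤w : 2 ≤ w
    2≤w = lower-bound⇒2≤ 4 0 28 (subst (28 ≤_) w≡ (s≤s 27≤3^m)) (from-yes (4 <? 28))
  ... | p , pp , 7≤p , p∣u | q , pq , 7≤q , q∣w =
    4∣+two-primes (divides (u * w) (trans s≡4uw (*-comm 4 (u * w)))) pp pq 7≤p 7≤q p≢q
                  (subst (p ∣_) (sym s≡4uw) (∣n⇒∣m*n 4 (∣m⇒∣m*n w p∣u)))
                  (subst (q ∣_) (sym s≡4uw) (∣n⇒∣m*n 4 (∣n⇒∣m*n u q∣w)))
    where
    1+u≡2w : 1 + u ≡ 2 * w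
    1+u≡2w = *-cancelˡ-≡ _ _ 2 (trans (double-succ u) (trans (cong (1 +_) u≡) (trans w≡ (*-assoc 2 2 w))))
      where
      double-succ : ∀ u → 2 * (1 + u) ≡ 1 + (1 + 2 * u)
      double-succ = solve-∀
    s≡4uw : s ≡ 4 * (u * w)
    s≡4uw = begin
      s                 ≡⟨ 2*m+1≡2*n+1⇒m≡n (trans sq (trans (cong (λ x → x * x) (sym u≡)) (square u))) ⟩
      2 * u * (1 + u)   ≡⟨ cong (2 * u *_) 1+u≡2w ⟩
      2 * u * (2 * w)   ≡⟨ regroup u w ⟩
      4 * (u * w)       ∎
      where
      open ≡-Reasoning
      square : ∀ u → (1 + 2 * u) * (1 + 2 * u) ≡ 2 * (2 * u * (1 + u)) + 1
      square = solve-∀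
      regroup : ∀ u w → 2 * u * (2 * w) ≡ 4 * (u * w)
      regroup = solve-∀
    p≢q : p ≢ q
    p≢q refl = >⇒≢ (<-≤-trans (s≤s (s≤s z≤n)) 7≤p)
                   (∣1⇒≡1 (∣m⇒∣1+m⇒∣1 p∣u (subst (p ∣_) (sym 1+u≡2w) (∣n⇒∣m*n 2 q∣w))))

  -- s = 8t(1 + 4t) with t = (3ᵐ − 1)/8
  weight-eighth : ∀ {t} → 1 + 8 * t ≡ 3 ^ m → 2 ∤ t × 5 ∤ t → Weight≥4 s
  weight-eighth {t} t≡ (2∤t , 5∤t)
    with rough-prime-factor 2≤t (7-rough 2∤t (3∤-next-to-power {a = 8} 1≤m (inj₁ t≡)) 5∤t)
    where
    2≤t : 2 ≤ t
    2≤t = lower-bound⇒2≤ 8 1 27 (subst (27 ≤_) (sym t≡) 27≤3^m) (from-yes (9 <? 27))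
  ... | p , pp , 7≤p , p∣t =
    8∣+prime (divides (t * (1 + 4 * t)) (trans s≡ (*-comm 8 (t * (1 + 4 * t))))) pp 7≤p
             (subst (p ∣_) (sym s≡) (∣n⇒∣m*n 8 (∣m⇒∣m*n (1 + 4 * t) p∣t)))
    where
    s≡ : s ≡ 8 * (t * (1 + 4 * t))
    s≡ = 2*m+1≡2*n+1⇒m≡n (trans sq (trans (cong (λ x → x * x) (sym t≡)) (square t)))
      where
      square : ∀ t → (1 + 8 * t) * (1 + 8 * t) ≡ 2 * (8 * (t * (1 + 4 * t))) + 1
      square = solve-∀

  σ**-odd-weight : Weight≥4 s
  σ**-odd-weight = by-residue (3^m-mod-80 m)
    where
    by-residue : ∃[ Z ] (3 ^ m ≡ 1 + Z * 80 ⊎ 3 ^ m ≡ 3 + Z * 80 ⊎ 3 ^ m ≡ 9 + Z * 80 ⊎ 3 ^ m ≡ 27 + Z * 80) →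
                 Weight≥4 s
    by-residue (Z , inj₁ 3ᵐ≡) =
      16∣ (divides (5 * Z + 200 * (Z * Z)) (2*m+1≡2*n+1⇒m≡n (trans sq (trans (cong (λ x → x * x) 3ᵐ≡) (square Z)))))
      where
      square : ∀ Z → (1 + Z * 80) * (1 + Z * 80) ≡ 2 * ((5 * Z + 200 * (Z * Z)) * 16) + 1
      square = solve-∀
    by-residue (Z , inj₂ (inj₁ 3ᵐ≡)) =
      weight-coprime-halves {1 + 40 * Z} {1 + 20 * Z} (trans (u-eq Z) (sym 3ᵐ≡)) (trans (cong (1 +_) 3ᵐ≡) (w-eq Z))
                            (2∤∧5∤-affine 1 40 Z) (2∤∧5∤-affine 1 20 Z)
      where
      u-eq : ∀ Z → 1 + 2 * (1 + 40 * Z) ≡ 3 + Z * 80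
      u-eq = solve-∀
      w-eq : ∀ Z → 1 + (3 + Z * 80) ≡ 4 * (1 + 20 * Z)
      w-eq = solve-∀
    by-residue (Z , inj₂ (inj₂ (inj₁ 3ᵐ≡))) =
      weight-eighth {1 + 10 * Z} (trans (t-eq Z) (sym 3ᵐ≡)) (2∤∧5∤-affine 1 10 Z)
      where
      t-eq : ∀ Z → 1 + 8 * (1 + 10 * Z) ≡ 9 + Z * 80
      t-eq = solve-∀
    by-residue (Z , inj₂ (inj₂ (inj₂ 3ᵐ≡))) =
      weight-coprime-halves {13 + 40 * Z} {7 + 20 * Z} (trans (u-eq Z) (sym 3ᵐ≡)) (trans (cong (1 +_) 3ᵐ≡) (w-eq Z))
                            (2∤∧5∤-affine 13 40 Z) (2∤∧5∤-affine 7 20 Z)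
      where
      u-eq : ∀ Z → 1 + 2 * (13 + 40 * Z) ≡ 27 + Z * 80
      u-eq = solve-∀
      w-eq : ∀ Z → 1 + (27 + Z * 80) ≡ 4 * (7 + 20 * Z)
      w-eq = solve-∀

σ**-pow-3-odd : ∀ j → 2 * σ**-pow 3 (suc (j + j)) + 1 ≡ 3 ^ suc j * 3 ^ suc j
σ**-pow-3-odd j = begin
  2 * σ**-pow 3 (suc (j + j)) + 1              ≡⟨ cong (λ x → 2 * x + 1) (σ**-pow-odd 3 j) ⟩
  2 * ∑[ i < suc (suc (j + j)) ] (3 ^ i) + 1   ≡⟨ geometric 2 (suc (suc (j + j))) ⟩
  3 ^ suc (suc (j + j))                        ≡⟨ cong (λ n → 3 ^ suc n) (+-suc j j) ⟨
  3 ^ (suc j + suc j)                          ≡⟨ ^-distribˡ-+-* 3 (suc j) (suc j) ⟩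
  3 ^ suc j * 3 ^ suc j                        ∎
  where open ≡-Reasoning

σ**-pow-3-even : ∀ k → 2 * σ**-pow 3 (k + k) + 2 * 3 ^ k + 1 ≡ 3 * (3 ^ k * 3 ^ k)
σ**-pow-3-even k = begin
  2 * σ**-pow 3 (k + k) + 2 * 3 ^ k + 1    ≡⟨ cong (_+ 1) (*-distribˡ-+ 2 (σ**-pow 3 (k + k)) (3 ^ k)) ⟨
  2 * (σ**-pow 3 (k + k) + 3 ^ k) + 1      ≡⟨ cong (λ x → 2 * x + 1) (σ**-pow-even 3 k) ⟩
  2 * ∑[ i < suc (k + k) ] (3 ^ i) + 1     ≡⟨ geometric 2 (suc (k + k)) ⟩
  3 * 3 ^ (k + k)                          ≡⟨ cong (3 *_) (^-distribˡ-+-* 3 k k) ⟩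
  3 * (3 ^ k * 3 ^ k)                      ∎
  where open ≡-Reasoning

9^h≡3^[h+h] : ∀ h → 9 ^ h ≡ 3 ^ (h + h)
9^h≡3^[h+h] h = trans (^-*-assoc 3 2 h) (cong (3 ^_) (cong (h +_) (+-identityʳ h)))

9^h≡1+[9^h/8]*8 : ∀ h → 9 ^ h ≡ 1 + 9 ^ h / 8 * 8
9^h≡1+[9^h/8]*8 h = m%n≡c⇒m≡c+[m/n]*n (9 ^ h) 8 (trans (^-%-cong {8} {9} {1} refl h) (cong (_% 8) (^-zeroˡ h)))

3^x+1-%-periodic : ∀ d T .{{_ : NonZero d}} .{{_ : NonZero T}} → 3 ^ T % d ≡ 1 % d →
                   ∀ x → (3 ^ x + 1) % d ≡ (3 ^ (x % T) % d + 1 % d) % d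
3^x+1-%-periodic d T 3ᵀ≡1 x =
  trans (%-distribˡ-+ (3 ^ x) 1 d) (cong (λ y → (y + 1 % d) % d) (^-%-periodic 3 T 3ᵀ≡1 x))

16∣σ**-pow-3-4h : ∀ h → 16 ∣ σ**-pow 3 ((h + h) + (h + h))
16∣σ**-pow-3-4h h = divides (Y + 6 * (Y * Y)) (*-cancelˡ-≡ _ _ 2 (+-cancelʳ-≡ (2 * K + 1) _ _ (begin
  2 * s + (2 * K + 1)                                   ≡⟨ +-assoc (2 * s) (2 * K) 1 ⟨
  2 * s + 2 * K + 1                                     ≡⟨ σ**-pow-3-even (h + h) ⟩
  3 * (K * K)                                           ≡⟨ cong (λ x → 3 * (x * x)) K≡ ⟩
  3 * ((1 + Y * 8) * (1 + Y * 8))                       ≡⟨ eq Y ⟩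
  2 * ((Y + 6 * (Y * Y)) * 16) + (2 * (1 + Y * 8) + 1)  ≡⟨ cong (λ x → 2 * ((Y + 6 * (Y * Y)) * 16) + (2 * x + 1)) K≡ ⟨
  2 * ((Y + 6 * (Y * Y)) * 16) + (2 * K + 1)            ∎)))
  where
  open ≡-Reasoning
  s = σ**-pow 3 ((h + h) + (h + h))
  K = 3 ^ (h + h)
  Y = 9 ^ h / 8
  K≡ : K ≡ 1 + Y * 8
  K≡ = trans (sym (9^h≡3^[h+h] h)) (9^h≡1+[9^h/8]*8 h)
  eq : ∀ Y → 3 * ((1 + Y * 8) * (1 + Y * 8)) ≡ 2 * ((Y + 6 * (Y * Y)) * 16) + (2 * (1 + Y * 8) + 1)
  eq = solve-∀

module ThreeToOddPower (h : ℕ) where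

  k : ℕ
  k = suc (h + h)

  Y : ℕ
  Y = 9 ^ h / 8

  A : ℕ
  A = 1 + 12 * Y

  B : ℕ
  B = 5 + 36 * Y

  3ᵏ≡1+2A : 3 ^ k ≡ 1 + 2 * A
  3ᵏ≡1+2A = begin
    3 * 3 ^ (h + h)   ≡⟨ cong (3 *_) (9^h≡3^[h+h] h) ⟨
    3 * 9 ^ h         ≡⟨ cong (3 *_) (9^h≡1+[9^h/8]*8 h) ⟩
    3 * (1 + Y * 8)   ≡⟨ eq Y ⟩
    1 + 2 * A         ∎
    where
    open ≡-Reasoning
    eq : ∀ Y → 3 * (1 + Y * 8) ≡ 1 + 2 * (1 + 12 * Y)
    eq = solve-∀

  2B≡3ᵏ⁺¹+1 : 2 * B ≡ 3 ^ suc k + 1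
  2B≡3ᵏ⁺¹+1 = trans (eq Y) (cong (λ x → 3 * x + 1) (sym 3ᵏ≡1+2A))
    where
    eq : ∀ Y → 2 * (5 + 36 * Y) ≡ 3 * (1 + 2 * (1 + 12 * Y)) + 1
    eq = solve-∀

  B≡3A+2 : B ≡ 3 * A + 2
  B≡3A+2 = eq Y
    where
    eq : ∀ Y → 5 + 36 * Y ≡ 3 * (1 + 12 * Y) + 2
    eq = solve-∀

  σ**-pow-3-k+k : σ**-pow 3 (k + k) ≡ 2 * (A * B)
  σ**-pow-3-k+k = *-cancelˡ-≡ _ _ 2 (+-cancelʳ-≡ (2 * (1 + 2 * A) + 1) _ _ (begin
    2 * s + (2 * (1 + 2 * A) + 1)               ≡⟨ +-assoc (2 * s) _ 1 ⟨
    2 * s + 2 * (1 + 2 * A) + 1                 ≡⟨ cong (λ x → 2 * s + 2 * x + 1) 3ᵏ≡1+2A ⟨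
    2 * s + 2 * 3 ^ k + 1                       ≡⟨ σ**-pow-3-even k ⟩
    3 * (3 ^ k * 3 ^ k)                         ≡⟨ cong (λ x → 3 * (x * x)) 3ᵏ≡1+2A ⟩
    3 * ((1 + 2 * A) * (1 + 2 * A))             ≡⟨ eq Y ⟩
    2 * (2 * (A * B)) + (2 * (1 + 2 * A) + 1)   ∎))
    where
    open ≡-Reasoning
    s = σ**-pow 3 (k + k)
    eq : ∀ Y → 3 * ((1 + 2 * (1 + 12 * Y)) * (1 + 2 * (1 + 12 * Y))) ≡
               2 * (2 * ((1 + 12 * Y) * (5 + 36 * Y))) + (2 * (1 + 2 * (1 + 12 * Y)) + 1)
    eq = solve-∀

  13≤A : 1 ≤ h → 13 ≤ A
  13≤A 1≤h = *-cancelˡ-≤ 2 (+-cancelˡ-≤ 1 _ _ (subst (27 ≤_) 3ᵏ≡1+2A (^-monoʳ-≤ 3 (s≤s (+-mono-≤ 1≤h 1≤h)))))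

  2∤A : 2 ∤ A
  2∤A = ∤-affine 1 12 Y (from-no (2 ∣? 1)) (from-yes (2 ∣? 12))

  3∤A : 3 ∤ A
  3∤A = 3∤-next-to-power {k} {2} {A} (s≤s z≤n) (inj₁ (sym 3ᵏ≡1+2A))

  2∤B : 2 ∤ B
  2∤B = ∤-affine 5 36 Y (from-no (2 ∣? 5)) (from-yes (2 ∣? 36))

  3∤B : 3 ∤ B
  3∤B = ∤-affine 5 36 Y (from-no (3 ∣? 5)) (from-yes (3 ∣? 36))

  ∣A⇒3ᵏ%≡1 : ∀ {d} .{{_ : NonZero d}} → d ∣ A → 3 ^ k % d ≡ 1 % d
  ∣A⇒3ᵏ%≡1 {d} d∣A = trans (cong (_% d) 3ᵏ≡1+2A) (∣⇒[1+m]%n≡1%n (∣n⇒∣m*n 2 d∣A))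

  ∣B⇒3ᵏ⁺¹+1%≡0 : ∀ {d} .{{_ : NonZero d}} → d ∣ B → (3 ^ suc k + 1) % d ≡ 0
  ∣B⇒3ᵏ⁺¹+1%≡0 {d} d∣B = n∣m⇒m%n≡0 _ d (subst (d ∣_) 2B≡3ᵏ⁺¹+1 (∣n⇒∣m*n 2 d∣B))

  3ᵏ%≡3*9^[h%T]% : ∀ d T .{{_ : NonZero d}} .{{_ : NonZero T}} → 9 ^ T % d ≡ 1 % d →
                   3 ^ k % d ≡ (3 * 9 ^ (h % T)) % d
  3ᵏ%≡3*9^[h%T]% d T 9ᵀ≡1 =
    trans (cong (λ x → (3 * x) % d) (sym (9^h≡3^[h+h] h))) (%-cong-* {a = 3} refl (^-%-periodic 9 T 9ᵀ≡1 h))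

  5∤A : 5 ∤ A
  5∤A 5∣A = from-yes (allUpTo? (λ r → ¬? ((3 * 9 ^ r) % 5 ≟ 1)) 2) (m%n<n h 2)
                     (trans (sym (3ᵏ%≡3*9^[h%T]% 5 2 refl)) (∣A⇒3ᵏ%≡1 5∣A))

  7∤A : 7 ∤ A
  7∤A 7∣A = from-yes (allUpTo? (λ r → ¬? ((3 * 9 ^ r) % 7 ≟ 1)) 3) (m%n<n h 3)
                     (trans (sym (3ᵏ%≡3*9^[h%T]% 7 3 refl)) (∣A⇒3ᵏ%≡1 7∣A))

  13∤B : 13 ∤ B
  13∤B 13∣B = from-yes (allUpTo? (λ r → ¬? ((3 ^ r % 13 + 1) % 13 ≟ 0)) 3) (m%n<n (suc k) 3)
                       (trans (sym (3^x+1-%-periodic 13 3 refl (suc k))) (∣B⇒3ᵏ⁺¹+1%≡0 13∣B))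

  module _ (2≤h : 2 ≤ h) where

    121≤A : 121 ≤ A
    121≤A = *-cancelˡ-≤ 2 (+-cancelˡ-≤ 1 _ _ (subst (243 ≤_) 3ᵏ≡1+2A (^-monoʳ-≤ 3 (s≤s (+-mono-≤ 2≤h 2≤h)))))

    365≤B : 365 ≤ B
    365≤B = *-cancelˡ-≤ 2 (subst (730 ≤_) (sym 2B≡3ᵏ⁺¹+1) (+-monoˡ-≤ 1 (^-monoʳ-≤ 3 (s≤s (s≤s (+-mono-≤ 2≤h 2≤h))))))

    -- 3 has order 39 modulo 169, and 797161 = (3¹³ − 1)/2 divides 3³⁹ − 1.
    A≢13^ : ∀ v → A ≢ 13 ^ v
    A≢13^ 0               A≡1  = <⇒≱ (from-yes (1 <? 121)) (subst (121 ≤_) A≡1 121≤A)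
    A≢13^ 1               A≡13 = <⇒≱ (from-yes (13 <? 121)) (subst (121 ≤_) A≡13 121≤A)
    A≢13^ v@(suc (suc u)) A≡   = contradiction (∣1⇒≡1 797161∣1) λ ()
      where
      169∣A : 169 ∣ A
      169∣A = divides (13 ^ u) (trans A≡ (eq (13 ^ u)))
        where
        eq : ∀ x → 13 * (13 * x) ≡ x * 169
        eq = solve-∀
      k%39≡0 : k % 39 ≡ 0
      k%39≡0 = from-yes (allUpTo? (λ r → (3 ^ r % 169 ≟ 1) →-dec (r ≟ 0)) 39) (m%n<n k 39)
                        (trans (sym (^-%-periodic {169} 3 39 refl k)) (∣A⇒3ᵏ%≡1 169∣A))
      3ᵏ%797161≡1 : 3 ^ k % 797161 ≡ 1
      3ᵏ%797161≡1 = trans (^-%-periodic {797161} 3 39 refl k) (cong (λ r → 3 ^ r % 797161) k%39≡0)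
      797161∣A : 797161 ∣ A
      797161∣A = coprime-divisor (from-yes (coprime? 797161 2))
                   ([1+m]%n≡1⇒n∣m (2 * A) 797161 (trans (cong (_% 797161) (sym 3ᵏ≡1+2A)) 3ᵏ%797161≡1))
      797161∣1 : 797161 ∣ 1
      797161∣1 = coprime-divisor (coprime-sym (coprime-^ˡ (from-yes (coprime? 13 797161)) v))
                                 (subst (797161 ∣_) (trans A≡ (sym (*-identityʳ (13 ^ v)))) 797161∣A)

    -- 3ˣ ≡ −1 (mod 25) forces x ≡ 10 (mod 20), and 1181 divides both 3¹⁰ + 1 and 3²⁰ − 1.
    B≢5^ : ∀ v → B ≢ 5 ^ v
    B≢5^ 0               B≡1 = <⇒≱ (from-yes (1 <? 365)) (subst (365 ≤_) B≡1 365≤B)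
    B≢5^ 1               B≡5 = <⇒≱ (from-yes (5 <? 365)) (subst (365 ≤_) B≡5 365≤B)
    B≢5^ v@(suc (suc u)) B≡  = contradiction (∣1⇒≡1 1181∣1) λ ()
      where
      x = suc k
      25∣B : 25 ∣ B
      25∣B = divides (5 ^ u) (trans B≡ (eq (5 ^ u)))
        where
        eq : ∀ x → 5 * (5 * x) ≡ x * 25
        eq = solve-∀
      x%20≡10 : x % 20 ≡ 10
      x%20≡10 = from-yes (allUpTo? (λ r → ((3 ^ r % 25 + 1) % 25 ≟ 0) →-dec (r ≟ 10)) 20) (m%n<n x 20)
                         (trans (sym (3^x+1-%-periodic 25 20 refl x)) (∣B⇒3ᵏ⁺¹+1%≡0 25∣B))
      3ˣ+1%1181≡0 : (3 ^ x + 1) % 1181 ≡ 0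
      3ˣ+1%1181≡0 = trans (3^x+1-%-periodic 1181 20 refl x) (cong (λ r → (3 ^ r % 1181 + 1) % 1181) x%20≡10)
      1181∣B : 1181 ∣ B
      1181∣B = coprime-divisor (from-yes (coprime? 1181 2))
                 (subst (1181 ∣_) (sym 2B≡3ᵏ⁺¹+1) (m%n≡0⇒n∣m _ 1181 3ˣ+1%1181≡0))
      1181∣1 : 1181 ∣ 1
      1181∣1 = coprime-divisor (coprime-sym (coprime-^ˡ (from-yes (coprime? 5 1181)) v))
                               (subst (1181 ∣_) (trans B≡ (sym (*-identityʳ (5 ^ v)))) 1181∣B)

-- The case M = 13ᵃ·41ᵇ

n<m⇒m*x≰n*x : ∀ m n x → .{{NonZero x}} → n < m → m * x ≤ n * x → ⊥
n<m⇒m*x≰n*x m n x n<m m*x≤n*x = <⇒≱ n<m (*-cancelʳ-≤ m n x m*x≤n*x)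

-- With f = 6 and M = 13ᵃ41ᵇ the equation reads c · σ**(13ᵃ)σ**(41ᵇ) = c′ · 13ᵃ41ᵇ, where
-- (c, c′) = (27·σ**(3⁶)·σ**(5), 48·3⁶·5) = (172692, 174960) for g = 1 and (748332, 874800) for g = 2.
-- The large constants are variables in the rearrangement lemmas below: a literal times a neutral
-- term only normalises by unfolding the literal, which is prohibitively slow.
172692*S≢174960*T : ∀ a b → 1 ≤ a → 1 ≤ b → 172692 * (σ**-pow 13 a * σ**-pow 41 b) ≢ 174960 * (13 ^ a * 41 ^ b)
172692*S≢174960*T a b 1≤a 1≤b = by-cases a b 1≤a 1≤b (a ≟ 2) (b ≟ 2)
  where
  by-cases : ∀ a b → 1 ≤ a → 1 ≤ b → Dec (a ≡ 2) → Dec (b ≡ 2) →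
             172692 * (σ**-pow 13 a * σ**-pow 41 b) ≢ 174960 * (13 ^ a * 41 ^ b)
  by-cases a b 1≤a 1≤b (no a≢2) _ eq =
    n<m⇒m*x≰n*x (172692 * 14) (13 * 174960) (13 ^ a * 41 ^ b) {{13ᵃ41ᵇ≢0}} (from-yes (2274480 <? 2417688)) (begin
      (172692 * 14) * (13 ^ a * 41 ^ b)              ≡⟨ reorder₁ 172692 14 (13 ^ a) (41 ^ b) ⟩
      172692 * ((13 ^ a * 14) * 41 ^ b)              ≤⟨ *-monoʳ-≤ 172692 bound ⟩
      172692 * ((13 * σ**-pow 13 a) * σ**-pow 41 b)  ≡⟨ reorder₂ 172692 13 (σ**-pow 13 a) (σ**-pow 41 b) ⟩
      13 * (172692 * (σ**-pow 13 a * σ**-pow 41 b))  ≡⟨ cong (13 *_) eq ⟩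
      13 * (174960 * (13 ^ a * 41 ^ b))              ≡⟨ *-assoc 13 174960 (13 ^ a * 41 ^ b) ⟨
      (13 * 174960) * (13 ^ a * 41 ^ b)              ∎)
    where
    open ≤-Reasoning
    13ᵃ41ᵇ≢0 = m*n≢0 (13 ^ a) (41 ^ b) {{m^n≢0 13 a}} {{m^n≢0 41 b}}
    reorder₁ : ∀ c d x y → (c * d) * (x * y) ≡ c * ((x * d) * y)
    reorder₁ = solve-∀
    reorder₂ : ∀ c d x y → c * ((d * x) * y) ≡ d * (c * (x * y))
    reorder₂ = solve-∀
    bound : (13 ^ a * 14) * 41 ^ b ≤ (13 * σ**-pow 13 a) * σ**-pow 41 b
    bound = *-mono-≤ (σ**-pow-≥-top-two 13 a 1≤a a≢2) (σ**-pow-≥-top 41 b 1≤b)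
  by-cases .2 b _ 1≤b (yes refl) (no b≢2) eq =
    n<m⇒m*x≰n*x (172692 * 170 * 42) (41 * 174960 * 169) (41 ^ b) {{m^n≢0 41 b}}
                (from-yes (1212297840 <? 1233020880)) (begin
      (172692 * 170 * 42) * 41 ^ b            ≡⟨ reorder₁ 172692 170 42 (41 ^ b) ⟩
      172692 * (170 * (41 ^ b * 42))          ≤⟨ *-monoʳ-≤ 172692 (*-monoʳ-≤ 170 bound) ⟩
      172692 * (170 * (41 * σ**-pow 41 b))    ≡⟨ reorder₂ 172692 170 41 (σ**-pow 41 b) ⟩
      41 * (172692 * (170 * σ**-pow 41 b))    ≡⟨ cong (41 *_) eq′ ⟩
      41 * (174960 * (169 * 41 ^ b))          ≡⟨ reorder₃ 41 174960 169 (41 ^ b) ⟩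
      (41 * 174960 * 169) * 41 ^ b            ∎)
    where
    open ≤-Reasoning
    reorder₁ : ∀ c d e x → (c * d * e) * x ≡ c * (d * (x * e))
    reorder₁ = solve-∀
    reorder₂ : ∀ c d e x → c * (d * (e * x)) ≡ e * (c * (d * x))
    reorder₂ = solve-∀
    reorder₃ : ∀ c d e x → c * (d * (e * x)) ≡ (c * d * e) * x
    reorder₃ = solve-∀
    bound : 41 ^ b * 42 ≤ 41 * σ**-pow 41 b
    bound = σ**-pow-≥-top-two 41 b 1≤b b≢2
    σ**-pow-13-2 : σ**-pow 13 2 ≡ 170
    σ**-pow-13-2 = refl
    13²≡169 : 13 ^ 2 ≡ 169
    13²≡169 = refl
    eq′ : 172692 * (170 * σ**-pow 41 b) ≡ 174960 * (169 * 41 ^ b)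
    eq′ = trans (cong (λ x → 172692 * (x * σ**-pow 41 b)) (sym σ**-pow-13-2))
                (trans eq (cong (λ x → 174960 * (x * 41 ^ b)) 13²≡169))
  by-cases .2 .2 _ _ (yes refl) (yes refl) eq = contradiction eq λ ()

748332*S≢874800*T : ∀ a b → 748332 * (σ**-pow 13 a * σ**-pow 41 b) ≢ 874800 * (13 ^ a * 41 ^ b)
748332*S≢874800*T a b eq =
  n<m⇒m*x≰n*x (12 * 40 * 874800) (748332 * 13 * 41) 13ᵃ41ᵇ {{13ᵃ41ᵇ≢0}} (from-yes (398860956 <? 419904000))
              (<⇒≤ (begin-strict
    (12 * 40 * 874800) * 13ᵃ41ᵇ                           ≡⟨ *-assoc (12 * 40) 874800 13ᵃ41ᵇ ⟩
    (12 * 40) * (874800 * 13ᵃ41ᵇ)                         ≡⟨ cong ((12 * 40) *_) eq ⟨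
    (12 * 40) * (748332 * (σ**-pow 13 a * σ**-pow 41 b))  ≡⟨ reorder₁ 748332 12 40 (σ**-pow 13 a) (σ**-pow 41 b) ⟩
    748332 * ((12 * σ**-pow 13 a) * (40 * σ**-pow 41 b))  <⟨ *-monoʳ-< 748332 bound ⟩
    748332 * ((13 * 13 ^ a) * (41 * 41 ^ b))              ≡⟨ reorder₂ 748332 13 41 (13 ^ a) (41 ^ b) ⟩
    (748332 * 13 * 41) * 13ᵃ41ᵇ                           ∎))
  where
  open ≤-Reasoning
  13ᵃ41ᵇ = 13 ^ a * 41 ^ b
  13ᵃ41ᵇ≢0 = m*n≢0 (13 ^ a) (41 ^ b) {{m^n≢0 13 a}} {{m^n≢0 41 b}}
  reorder₁ : ∀ c d e x y → (d * e) * (c * (x * y)) ≡ c * ((d * x) * (e * y))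
  reorder₁ = solve-∀
  reorder₂ : ∀ c d e x y → c * ((d * x) * (e * y)) ≡ (c * d * e) * (x * y)
  reorder₂ = solve-∀
  bound : (12 * σ**-pow 13 a) * (40 * σ**-pow 41 b) < (13 * 13 ^ a) * (41 * 41 ^ b)
  bound = *-mono-< (σ**-pow-< 12 a) (σ**-pow-< 40 b)

-- σ**(N) = 3N for N = 2⁴·3ᶠ·5ᵍ·M, with σ**(2⁴) = 27 already evaluated
record Solution (f g M : ℕ) : Set where
  field
    {{M≢0}}  : NonZero M
    2∤M      : 2 ∤ M
    3∤M      : 3 ∤ M
    5∤M      : 5 ∤ M
    equation : 27 * (σ**-pow 3 f * (σ**-pow 5 g * σ** M)) ≡ 3 * (16 * (3 ^ f * (5 ^ g * M)))

module SolutionProperties {f g M : ℕ} (sol : Solution f g M) where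

  open Solution sol

  private
    X : ℕ
    X = 3 ^ f * (5 ^ g * M)
    instance
      X≢0 : NonZero X
      X≢0 = m*n≢0 (3 ^ f) (5 ^ g * M) {{m^n≢0 3 f}} {{m*n≢0 (5 ^ g) M {{m^n≢0 5 g}}}}

  2∣σ**-pow-3 : 2 ∣ σ**-pow 3 f
  2∣σ**-pow-3 = 2∣σ**-pow (from-no (2 ∣? 3)) f

  2∣σ**-pow-5 : 2 ∣ σ**-pow 5 g
  2∣σ**-pow-5 = 2∣σ**-pow (from-no (2 ∣? 5)) g

  32∤σ**-product : 32 ∤ σ**-pow 3 f * (σ**-pow 5 g * σ** M)
  32∤σ**-product 32∣ = [ from-no (2 ∣? 3) , 2∤X ]′ (euclidsLemma 3 X prime[2] (*-cancelˡ-∣ 16 16*2∣16*3X))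
    where
    2∤X : 2 ∤ X
    2∤X = ∤-* prime[2] (∤-^ prime[2] (from-no (2 ∣? 3)) f) (∤-* prime[2] (∤-^ prime[2] (from-no (2 ∣? 5)) g) 2∤M)
    16*2∣16*3X : 16 * 2 ∣ 16 * (3 * X)
    16*2∣16*3X = subst (32 ∣_) (trans equation (x∙yz≈y∙xz 3 16 X)) (∣n⇒∣m*n 27 32∣)

  two-adic-budget : ∀ x ps → 2 ^ x ∣ σ**-pow 3 f * σ**-pow 5 g →
                    All Prime ps → Unique ps → All (_∣ M) ps → x + length ps ≡ 5 → ⊥
  two-adic-budget x ps 2ˣ∣ pps unique ps∣M x+ℓ≡5 =
    32∤σ**-product (subst₂ _∣_ 2ˣ2ˡ≡32 (*-assoc (σ**-pow 3 f) _ _)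
                           (*-pres-∣ 2ˣ∣ (2^length∣σ** ps 2∤M pps unique ps∣M)))
    where
    2ˣ2ˡ≡32 : 2 ^ x * 2 ^ length ps ≡ 32
    2ˣ2ˡ≡32 = trans (sym (^-distribˡ-+-* 2 x (length ps))) (cong (2 ^_) x+ℓ≡5)

  large-prime-∣M : ∀ {p} → Prime p → 7 ≤ p → p ∣ σ**-pow 3 f * σ**-pow 5 g → p ∣ M
  large-prime-∣M {p} pp 7≤p p∣ =
    cancel (p∤small 5 ∘ ∣^⇒∣ pp g) (cancel (p∤small 3 ∘ ∣^⇒∣ pp f)
      (cancel (p∤small 2 ∘ ∣^⇒∣ pp 4) (cancel (p∤small 3) p∣3*16X)))
    where
    p∤small : ∀ n .{{_ : NonZero n}} {n<7 : True (n <? 7)} → p ∤ n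
    p∤small n {n<7} p∣n = <⇒≱ (toWitness n<7) (≤-trans 7≤p (∣⇒≤ p∣n))
    cancel : ∀ {a b} → p ∤ a → p ∣ a * b → p ∣ b
    cancel p∤a = coprime-divisor (prime-∤⇒coprime pp p∤a)
    p∣3*16X : p ∣ 3 * (16 * X)
    p∣3*16X = subst (p ∣_) equation (∣n⇒∣m*n 27 (subst (p ∣_) (*-assoc (σ**-pow 3 f) _ _) (∣m⇒∣m*n (σ** M) p∣)))

  abundance : ∀ a b c d → 3 ^ f * a ≤ b * σ**-pow 3 f → 5 ^ g * c ≤ d * σ**-pow 5 g →
              48 * (b * d) < 27 * (a * c) → ⊥
  abundance a b c d lb₃ lb₅ = flip (n<m⇒m*x≰n*x (27 * (a * c)) (3 * 16 * (b * d)) X) (begin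
    27 * (a * c) * X                                          ≡⟨ reorder₁ 27 a c (3 ^ f) (5 ^ g) M ⟩
    27 * ((3 ^ f * a) * ((5 ^ g * c) * M))                    ≤⟨ *-monoʳ-≤ 27 (*-mono-≤ lb₃ (*-mono-≤ lb₅ (σ**-≥ M))) ⟩
    27 * ((b * σ**-pow 3 f) * ((d * σ**-pow 5 g) * σ** M))    ≡⟨ reorder₂ 27 b d (σ**-pow 3 f) (σ**-pow 5 g) (σ** M) ⟩
    (b * d) * (27 * (σ**-pow 3 f * (σ**-pow 5 g * σ** M)))    ≡⟨ cong ((b * d) *_) equation ⟩
    (b * d) * (3 * (16 * X))                                  ≡⟨ reorder₃ (b * d) 3 16 X ⟩
    3 * 16 * (b * d) * X                                      ∎)
    where
    open ≤-Reasoning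
    reorder₁ : ∀ k a c x y m → k * (a * c) * (x * (y * m)) ≡ k * ((x * a) * ((y * c) * m))
    reorder₁ = solve-∀
    reorder₂ : ∀ k b d s t u → k * ((b * s) * ((d * t) * u)) ≡ (b * d) * (k * (s * (t * u)))
    reorder₂ = solve-∀
    reorder₃ : ∀ e k l x → e * (k * (l * x)) ≡ k * l * e * x
    reorder₃ = solve-∀

  weight≥4-impossible : Weight≥4 (σ**-pow 3 f) → ⊥
  weight≥4-impossible (16∣ 16∣s) = two-adic-budget 5 [] (*-pres-∣ 16∣s 2∣σ**-pow-5) [] [] [] refl
  weight≥4-impossible (8∣+prime 8∣s pp 7≤p p∣s) =
    two-adic-budget 4 (_ ∷ []) (*-pres-∣ 8∣s 2∣σ**-pow-5) (pp ∷ []) ([] ∷ [])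
                    (large-prime-∣M pp 7≤p (∣m⇒∣m*n _ p∣s) ∷ []) refl
  weight≥4-impossible (4∣+two-primes 4∣s pp pq 7≤p 7≤q p≢q p∣s q∣s) =
    two-adic-budget 3 (_ ∷ _ ∷ []) (*-pres-∣ 4∣s 2∣σ**-pow-5) (pp ∷ pq ∷ []) ((p≢q ∷ []) ∷ [] ∷ [])
                    (large-prime-∣M pp 7≤p (∣m⇒∣m*n _ p∣s) ∷ large-prime-∣M pq 7≤q (∣m⇒∣m*n _ q∣s) ∷ []) refl

no-solution-f-odd : ∀ {f g M} j → f ≡ suc (j + j) → 2 ≤ j → ¬ Solution f g M
no-solution-f-odd j refl 2≤j sol = weight≥4-impossible (σ**-odd-weight (s≤s 2≤j) (σ**-pow-3-odd j))
  where open SolutionProperties sol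

no-solution-4∣f : ∀ {f g M} h → f ≡ (h + h) + (h + h) → ¬ Solution f g M
no-solution-4∣f h refl sol = weight≥4-impossible (16∣ (16∣σ**-pow-3-4h h))
  where open SolutionProperties sol

no-solution-abundant : ∀ {f g M} → 5 ≤ f → g ≡ 3 ⊎ 5 ≤ g → ¬ Solution f g M
no-solution-abundant {f} {g} 5≤f g≡3⊎5≤g sol = abundance 13 9 31 25 lb₃ (lb₅ g≡3⊎5≤g) (from-yes (10800 <? 10881))
  where
  open SolutionProperties sol
  lb₃ : 3 ^ f * 13 ≤ 9 * σ**-pow 3 f
  lb₃ = σ**-pow-≥-top-terms 3 2 f 5≤f
  lb₅ : g ≡ 3 ⊎ 5 ≤ g → 5 ^ g * 31 ≤ 25 * σ**-pow 5 g
  lb₅ (inj₁ refl) = from-yes (5 ^ 3 * 31 ≤? 25 * σ**-pow 5 3)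
  lb₅ (inj₂ 5≤g)  = σ**-pow-≥-top-terms 5 2 g 5≤g

no-solution-g≡1 : ∀ {f M} → 9 ≤ f → ¬ Solution f 1 M
no-solution-g≡1 {f} 9≤f sol =
  abundance 121 81 6 5 lb₃ (from-yes (5 ^ 1 * 6 ≤? 5 * σ**-pow 5 1)) (from-yes (19440 <? 19602))
  where
  open SolutionProperties sol
  lb₃ : 3 ^ f * 121 ≤ 81 * σ**-pow 3 f
  lb₃ = σ**-pow-≥-top-terms 3 4 f 9≤f

module _ {f g M : ℕ} (h : ℕ) (f≡ : f ≡ suc (h + h) + suc (h + h)) (sol : Solution f g M) where

  open ThreeToOddPower h

  σ**-pow-3-f≡2AB : σ**-pow 3 f ≡ 2 * (A * B)
  σ**-pow-3-f≡2AB = trans (cong (σ**-pow 3) f≡) σ**-pow-3-k+k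

  A∣σ**-product : A ∣ σ**-pow 3 f * σ**-pow 5 g
  A∣σ**-product = ∣m⇒∣m*n (σ**-pow 5 g) (subst (A ∣_) (sym σ**-pow-3-f≡2AB) (∣n⇒∣m*n 2 (m∣m*n B)))

  B∣σ**-product : B ∣ σ**-pow 3 f * σ**-pow 5 g
  B∣σ**-product = ∣m⇒∣m*n (σ**-pow 5 g) (subst (B ∣_) (sym σ**-pow-3-f≡2AB) (∣n⇒∣m*n 2 (n∣m*n A)))

no-solution-g≡4 : ∀ {f M} h → f ≡ suc (h + h) + suc (h + h) → 1 ≤ h → ¬ Solution f 4 M
no-solution-g≡4 {f} {M} h f≡ 1≤h sol = use (rough-prime-factor 2≤A (7-rough 2∤A 3∤A 5∤A))
  where
  open ThreeToOddPower h
  open SolutionProperties sol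
  2≤A : 2 ≤ A
  2≤A = ≤-trans (s≤s (s≤s z≤n)) (13≤A 1≤h)
  σ**-pow-5-4 : σ**-pow 5 4 ≡ 4 * 189
  σ**-pow-5-4 = refl
  4∣σ**-pow-5-4 : 4 ∣ σ**-pow 5 4
  4∣σ**-pow-5-4 = subst (4 ∣_) (sym σ**-pow-5-4) (m∣m*n 189)
  7∣M : 7 ∣ M
  7∣M = large-prime-∣M prime[7] ≤-refl (∣n⇒∣m*n (σ**-pow 3 f) (subst (7 ∣_) (sym σ**-pow-5-4) (from-yes (7 ∣? 756))))
  use : ∃[ p ] Prime p × 7 ≤ p × p ∣ A → ⊥
  use (p , pp , 7≤p , p∣A) =
    two-adic-budget 3 (7 ∷ p ∷ []) (*-pres-∣ 2∣σ**-pow-3 4∣σ**-pow-5-4) (prime[7] ∷ pp ∷ []) ((7≢p ∷ []) ∷ [] ∷ [])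
                    (7∣M ∷ large-prime-∣M pp 7≤p (∣-trans p∣A (A∣σ**-product h f≡ sol)) ∷ []) refl
    where
    7≢p : 7 ≢ p
    7≢p refl = 7∤A p∣A

no-solution-g≡2 : ∀ {f M} h → f ≡ suc (h + h) + suc (h + h) → 2 ≤ h → ¬ Solution f 2 M
no-solution-g≡2 {f} {M} h f≡ 2≤h sol =
  use (prime-power-free-part prime[13] (A≢13^ 2≤h)) (prime-power-free-part prime[5] (B≢5^ 2≤h))
  where
  open ThreeToOddPower h
  open SolutionProperties sol
  σ**-pow-5-2 : σ**-pow 5 2 ≡ 26
  σ**-pow-5-2 = refl
  13∣M : 13 ∣ M
  13∣M = large-prime-∣M prime[13] (from-yes (7 ≤? 13))
                        (∣n⇒∣m*n (σ**-pow 3 f) (subst (13 ∣_) (sym σ**-pow-5-2) (from-yes (13 ∣? 26))))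
  use : ∃[ n ] 2 ≤ n × n ∣ A × 13 ∤ n → ∃[ n ] 2 ≤ n × n ∣ B × 5 ∤ n → ⊥
  use (n , 2≤n , n∣A , 13∤n) (m , 2≤m , m∣B , 5∤m) =
    use′ (rough-prime-factor 2≤n (7-rough (2∤A ∘ flip ∣-trans n∣A) (3∤A ∘ flip ∣-trans n∣A) (5∤A ∘ flip ∣-trans n∣A)))
         (rough-prime-factor 2≤m (7-rough (2∤B ∘ flip ∣-trans m∣B) (3∤B ∘ flip ∣-trans m∣B) 5∤m))
    where
    use′ : ∃[ p ] Prime p × 7 ≤ p × p ∣ n → ∃[ q ] Prime q × 7 ≤ q × q ∣ m → ⊥
    use′ (p , pp , 7≤p , p∣n) (q , pq , 7≤q , q∣m) =
      two-adic-budget 2 (13 ∷ p ∷ q ∷ []) (*-pres-∣ 2∣σ**-pow-3 2∣σ**-pow-5) (prime[13] ∷ pp ∷ pq ∷ [])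
                      ((13≢p ∷ 13≢q ∷ []) ∷ (p≢q ∷ []) ∷ [] ∷ [])
                      (13∣M ∷ large-prime-∣M pp 7≤p (∣-trans p∣A (A∣σ**-product h f≡ sol))
                            ∷ large-prime-∣M pq 7≤q (∣-trans q∣B (B∣σ**-product h f≡ sol)) ∷ []) refl
      where
      p∣A : p ∣ A
      p∣A = ∣-trans p∣n n∣A
      q∣B : q ∣ B
      q∣B = ∣-trans q∣m m∣B
      13≢p : 13 ≢ p
      13≢p refl = 13∤n p∣n
      13≢q : 13 ≢ q
      13≢q refl = 13∤B q∣B
      p≢q : p ≢ q
      p≢q refl = <⇒≱ (from-yes (2 <? 7)) (≤-trans 7≤p (∣⇒≤ (∣m+n∣m⇒∣n (subst (p ∣_) B≡3A+2 q∣B) (∣n⇒∣m*n 3 p∣A))))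

module _ {g M : ℕ} (sol : Solution 6 g M) where

  open Solution sol
  open SolutionProperties sol

  M≡13^a*41^b : ∃[ a ] ∃[ b ] 1 ≤ a × 1 ≤ b × M ≡ 13 ^ a * 41 ^ b × σ** M ≡ σ**-pow 13 a * σ**-pow 41 b
  M≡13^a*41^b = σ**-two-prime-powers prime[13] prime[41] (λ ()) 13∣M 41∣M only-13-41
    where
    σ**-pow-3-6 : σ**-pow 3 6 ≡ 2 * 13 * 41
    σ**-pow-3-6 = refl
    13∣M : 13 ∣ M
    13∣M = large-prime-∣M prime[13] (from-yes (7 ≤? 13))
             (∣m⇒∣m*n {m = σ**-pow 3 6} (σ**-pow 5 g) (subst (13 ∣_) (sym σ**-pow-3-6) (∣m⇒∣m*n 41 (n∣m*n 2))))
    41∣M : 41 ∣ M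
    41∣M = large-prime-∣M prime[41] (from-yes (7 ≤? 41))
             (∣m⇒∣m*n {m = σ**-pow 3 6} (σ**-pow 5 g) (subst (41 ∣_) (sym σ**-pow-3-6) (n∣m*n (2 * 13))))
    only-13-41 : ∀ {r} → Prime r → r ∣ M → r ≡ 13 ⊎ r ≡ 41
    only-13-41 {r} pr r∣M with r ≟ 13 | r ≟ 41
    ... | yes r≡13 | _        = inj₁ r≡13
    ... | no _     | yes r≡41 = inj₂ r≡41
    ... | no r≢13  | no r≢41  =
      ⊥-elim (two-adic-budget 2 (13 ∷ 41 ∷ r ∷ []) (*-pres-∣ 2∣σ**-pow-3 2∣σ**-pow-5) (prime[13] ∷ prime[41] ∷ pr ∷ [])
                              (((λ ()) ∷ (r≢13 ∘ sym) ∷ []) ∷ ((r≢41 ∘ sym) ∷ []) ∷ [] ∷ [])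
                              (13∣M ∷ 41∣M ∷ r∣M ∷ []) refl)

  reduced-equation : (27 * σ**-pow 3 6 * σ**-pow 5 g) * σ** M ≡ (3 * 16 * 3 ^ 6 * 5 ^ g) * M
  reduced-equation =
    trans (assoc₃ 27 (σ**-pow 3 6) (σ**-pow 5 g) (σ** M)) (trans equation (assoc₄ 3 16 (3 ^ 6) (5 ^ g) M))
    where
    assoc₃ : ∀ k s t S → (k * s * t) * S ≡ k * (s * (t * S))
    assoc₃ = solve-∀
    assoc₄ : ∀ l m x y T → l * (m * (x * (y * T))) ≡ (l * m * x * y) * T
    assoc₄ = solve-∀

no-solution-f≡6 : ∀ {g M} → 1 ≤ g → g ≤ 2 → ¬ Solution 6 g M
no-solution-f≡6 {0} () _ _
no-solution-f≡6 {1} {M} _ _ sol = impossible (M≡13^a*41^b sol)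
  where
  constants : 27 * σ**-pow 3 6 * σ**-pow 5 1 ≡ 172692 × 3 * 16 * 3 ^ 6 * 5 ^ 1 ≡ 174960
  constants = refl , refl
  eq : 172692 * σ** M ≡ 174960 * M
  eq = subst₂ (λ x y → x * σ** M ≡ y * M) (proj₁ constants) (proj₂ constants) (reduced-equation sol)
  impossible : ∃[ a ] ∃[ b ] 1 ≤ a × 1 ≤ b × M ≡ 13 ^ a * 41 ^ b × σ** M ≡ σ**-pow 13 a * σ**-pow 41 b → ⊥
  impossible (a , b , 1≤a , 1≤b , M≡ , σ**M≡) =
    172692*S≢174960*T a b 1≤a 1≤b (trans (cong (172692 *_) (sym σ**M≡)) (trans eq (cong (174960 *_) M≡)))
no-solution-f≡6 {2} {M} _ _ sol = impossible (M≡13^a*41^b sol)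
  where
  constants : 27 * σ**-pow 3 6 * σ**-pow 5 2 ≡ 748332 × 3 * 16 * 3 ^ 6 * 5 ^ 2 ≡ 874800
  constants = refl , refl
  eq : 748332 * σ** M ≡ 874800 * M
  eq = subst₂ (λ x y → x * σ** M ≡ y * M) (proj₁ constants) (proj₂ constants) (reduced-equation sol)
  impossible : ∃[ a ] ∃[ b ] 1 ≤ a × 1 ≤ b × M ≡ 13 ^ a * 41 ^ b × σ** M ≡ σ**-pow 13 a * σ**-pow 41 b → ⊥
  impossible (a , b , 1≤a , 1≤b , M≡ , σ**M≡) =
    748332*S≢874800*T a b (trans (cong (748332 *_) (sym σ**M≡)) (trans eq (cong (874800 *_) M≡)))
no-solution-f≡6 {suc (suc (suc _))} _ (s≤s (s≤s ())) _

9≤k+k : ∀ h → 2 ≤ h → 9 ≤ suc (h + h) + suc (h + h)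
9≤k+k h 2≤h = ≤-trans (from-yes (9 ≤? 10)) (+-mono-≤ 5≤k 5≤k)
  where
  5≤k : 5 ≤ suc (h + h)
  5≤k = s≤s (+-mono-≤ 2≤h 2≤h)

no-solution-f≡2[4] : ∀ {f g M} h → f ≡ suc (h + h) + suc (h + h) → 5 ≤ f → 1 ≤ g → ¬ Solution f g M
no-solution-f≡2[4] 0 refl (s≤s (s≤s ()))
no-solution-f≡2[4] {g = 0} h f≡ 5≤f ()
no-solution-f≡2[4] {g = 1} 1               refl _   _ = no-solution-f≡6 (s≤s z≤n) (s≤s z≤n)
no-solution-f≡2[4] {g = 1} h@(suc (suc _)) f≡   _   _ =
  no-solution-g≡1 (subst (9 ≤_) (sym f≡) (9≤k+k h (s≤s (s≤s z≤n))))
no-solution-f≡2[4] {g = 2} 1               refl _   _ = no-solution-f≡6 (s≤s z≤n) ≤-refl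
no-solution-f≡2[4] {g = 2} h@(suc (suc _)) f≡   _   _ = no-solution-g≡2 h f≡ (s≤s (s≤s z≤n))
no-solution-f≡2[4] {g = 3} h               f≡   5≤f _ = no-solution-abundant 5≤f (inj₁ refl)
no-solution-f≡2[4] {g = 4} h@(suc _)       f≡   _   _ = no-solution-g≡4 h f≡ (s≤s z≤n)
no-solution-f≡2[4] {g = suc (suc (suc (suc (suc _))))} h f≡ 5≤f _ =
  no-solution-abundant 5≤f (inj₂ (s≤s (s≤s (s≤s (s≤s (s≤s z≤n))))))

no-solution : ∀ {f g M} → 5 ≤ f → 1 ≤ g → ¬ Solution f g M
no-solution {f} 5≤f 1≤g with even⊎odd f
... | inj₂ (j , f≡) = no-solution-f-odd j f≡ (2≤j j (subst (5 ≤_) f≡ 5≤f))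
  where
  2≤j : ∀ j → 5 ≤ suc (j + j) → 2 ≤ j
  2≤j 0             (s≤s ())
  2≤j 1             (s≤s (s≤s (s≤s ())))
  2≤j (suc (suc _)) _ = s≤s (s≤s z≤n)
... | inj₁ (k , f≡) with even⊎odd k
...   | inj₁ (h , refl) = no-solution-4∣f h f≡
...   | inj₂ (h , refl) = no-solution-f≡2[4] h f≡ 5≤f 1≤g

∥⇒≡* : ∀ p a {N} → p ^ a ∥ N → ∃[ N′ ] N ≡ p ^ a * N′ × p ∤ N′
∥⇒≡* p a (divides N′ N≡N′pᵃ , pᵃ⁺¹∤N) = N′ , N≡pᵃN′ , pᵃ⁺¹∤N ∘ subst (p ^ suc a ∣_) (sym N≡pᵃN′) ∘ pᵃ⁺¹∣
  where
  N≡pᵃN′ = trans N≡N′pᵃ (*-comm N′ (p ^ a))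
  pᵃ⁺¹∣ : p ∣ N′ → p ^ suc a ∣ p ^ a * N′
  pᵃ⁺¹∣ p∣N′ = subst (_∣ p ^ a * N′) (*-comm (p ^ a) p) (*-monoʳ-∣ (p ^ a) p∣N′)

∥-cancelˡ : ∀ {p a c N} → Coprime (p ^ a) c → p ^ a ∥ (c * N) → p ^ a ∥ N
∥-cancelˡ {c = c} pᵃ⊥c (pᵃ∣cN , pᵃ⁺¹∤cN) = coprime-divisor pᵃ⊥c pᵃ∣cN , pᵃ⁺¹∤cN ∘ ∣n⇒∣m*n c

2⁴3ᶠ-part : ∀ {N} f → 2 ^ 4 ∥ N → 3 ^ f ∥ N → ∃[ N₂ ] N ≡ 2 ^ 4 * (3 ^ f * N₂) × 2 ∤ N₂ × 3 ∤ N₂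
2⁴3ᶠ-part {N} f 2⁴∥N 3ᶠ∥N = three-part (∥⇒≡* 2 4 2⁴∥N)
  where
  3ᶠ⊥2⁴ : Coprime (3 ^ f) (2 ^ 4)
  3ᶠ⊥2⁴ = coprime-^ˡ (prime-∤⇒coprime prime[3] (from-no (3 ∣? 16))) f
  three-part : ∃[ N₁ ] N ≡ 2 ^ 4 * N₁ × 2 ∤ N₁ → ∃[ N₂ ] N ≡ 2 ^ 4 * (3 ^ f * N₂) × 2 ∤ N₂ × 3 ∤ N₂
  three-part (N₁ , N≡2⁴N₁ , 2∤N₁) = combine (∥⇒≡* 3 f (∥-cancelˡ {3} {f} 3ᶠ⊥2⁴ (subst (3 ^ f ∥_) N≡2⁴N₁ 3ᶠ∥N)))
    where
    combine : ∃[ N₂ ] N₁ ≡ 3 ^ f * N₂ × 3 ∤ N₂ → ∃[ N₂ ] N ≡ 2 ^ 4 * (3 ^ f * N₂) × 2 ∤ N₂ × 3 ∤ N₂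
    combine (N₂ , N₁≡3ᶠN₂ , 3∤N₂) =
      N₂ , trans N≡2⁴N₁ (cong (2 ^ 4 *_) N₁≡3ᶠN₂) , 2∤N₁ ∘ subst (2 ∣_) (sym N₁≡3ᶠN₂) ∘ ∣n⇒∣m*n (3 ^ f) , 3∤N₂

solution-of : ∀ f N₂ → .{{NonZero N₂}} → σ** (2 ^ 4 * (3 ^ f * N₂)) ≡ 3 * (2 ^ 4 * (3 ^ f * N₂)) →
              2 ∤ N₂ → 3 ∤ N₂ → 1 ≤ f → 5 ∣ 2 ^ 4 * (3 ^ f * N₂) → ∃[ g ] ∃[ M ] 1 ≤ g × Solution f g M
solution-of f N₂ σN≡3N 2∤N₂ 3∤N₂ 1≤f 5∣N = exponent , cofactor , 1≤exponent , solution
  where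
  cancel : ∀ {a b} → 5 ∤ a → 5 ∣ a * b → 5 ∣ b
  cancel 5∤a = coprime-divisor (prime-∤⇒coprime prime[5] 5∤a)
  5∣N₂ : 5 ∣ N₂
  5∣N₂ = cancel (∤-^ prime[5] (from-no (5 ∣? 3)) f) (cancel (from-no (5 ∣? 16)) 5∣N)
  open PrimePowerSplit (prime-power-split-σ** prime[5] N₂ 5∣N₂)
  N₂∤ : ∀ {d} → d ∤ N₂ → d ∤ cofactor
  N₂∤ d∤N₂ = d∤N₂ ∘ flip ∣-trans cofactor∣M
  2∤3ᶠN₂ : 2 ∤ 3 ^ f * N₂
  2∤3ᶠN₂ = ∤-* prime[2] (∤-^ prime[2] (from-no (2 ∣? 3)) f) 2∤N₂
  constants : σ**-pow 2 4 ≡ 27 × 2 ^ 4 ≡ 16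
  constants = refl , refl
  equation : 27 * (σ**-pow 3 f * (σ**-pow 5 exponent * σ** cofactor)) ≡ 3 * (16 * (3 ^ f * (5 ^ exponent * cofactor)))
  equation = begin
    27 * (σ**-pow 3 f * (σ**-pow 5 exponent * σ** cofactor)) ≡⟨ cong (λ x → 27 * (σ**-pow 3 f * x)) σ**≡ ⟨
    27 * (σ**-pow 3 f * σ** N₂)                              ≡⟨ cong (27 *_) (σ**-^* prime[3] f 1≤f 3∤N₂) ⟨
    27 * σ** (3 ^ f * N₂)                                    ≡⟨ cong (_* σ** (3 ^ f * N₂)) (proj₁ constants) ⟨
    σ**-pow 2 4 * σ** (3 ^ f * N₂)                           ≡⟨ σ**-^* prime[2] 4 {{3ᶠN₂≢0}} (s≤s z≤n) 2∤3ᶠN₂ ⟨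
    σ** (2 ^ 4 * (3 ^ f * N₂))                               ≡⟨ σN≡3N ⟩
    3 * (2 ^ 4 * (3 ^ f * N₂))                               ≡⟨ cong (λ x → 3 * (x * (3 ^ f * N₂))) (proj₂ constants) ⟩
    3 * (16 * (3 ^ f * N₂))                                  ≡⟨ cong (λ x → 3 * (16 * (3 ^ f * x))) M≡ ⟩
    3 * (16 * (3 ^ f * (5 ^ exponent * cofactor)))           ∎
    where
    open ≡-Reasoning
    3ᶠN₂≢0 = m*n≢0 (3 ^ f) N₂ {{m^n≢0 3 f}}
  solution : Solution f exponent cofactor
  solution = record { M≢0 = cofactor≢0 ; 2∤M = N₂∤ 2∤N₂ ; 3∤M = N₂∤ 3∤N₂ ; 5∤M = p∤cofactor ; equation = equation }

triperfect⇒solution : ∀ N f → .{{NonZero N}} → σ** N ≡ 3 * N → 2 ^ 4 ∥ N → 3 ^ f ∥ N → 1 ≤ f → 5 ∣ N →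
                      ∃[ g ] ∃[ M ] 1 ≤ g × Solution f g M
triperfect⇒solution N f {{N≢0}} σN≡3N 2⁴∥N 3ᶠ∥N 1≤f 5∣N = from-parts (2⁴3ᶠ-part f 2⁴∥N 3ᶠ∥N)
  where
  from-parts : ∃[ N₂ ] N ≡ 2 ^ 4 * (3 ^ f * N₂) × 2 ∤ N₂ × 3 ∤ N₂ → ∃[ g ] ∃[ M ] 1 ≤ g × Solution f g M
  from-parts (N₂ , N≡ , 2∤N₂ , 3∤N₂) =
    solution-of f N₂ {{N₂≢0}} (subst (λ n → σ** n ≡ 3 * n) N≡ σN≡3N) 2∤N₂ 3∤N₂ 1≤f (subst (5 ∣_) N≡ 5∣N)
    where
    N₂≢0 = m*n≢0⇒n≢0 (3 ^ f) {{m*n≢0⇒n≢0 (2 ^ 4) {{subst NonZero N≡ N≢0}}}}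

lemma3p7 : (N e f : ℕ) → NonZero N → σ** N ≡ 3 * N → 2 ^ e ∥ N → 3 ^ f ∥ N →
    e ≡ 4 → f ≥ 5 → ¬ (5 ∣ N)
lemma3p7 N e f N≢0 σN≡3N 2⁴∥N 3ᶠ∥N refl 5≤f 5∣N =
  let g , M , 1≤g , solution = triperfect⇒solution N f {{N≢0}} σN≡3N 2⁴∥N 3ᶠ∥N (≤-trans (s≤s z≤n) 5≤f) 5∣N
  in  no-solution 5≤f 1≤g solution
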